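{- Fix an integer $n\geq 1$. Let $X_n=[\overline{a_1,a_2,a_3}]$ be a continued fraction of type $(0,3)$ with $a_1,a_2,a_3\in\mathbb{Z}[X_{n-1}]$. Then there exists $\varepsilon\in RE_n^-$ such that $a_1=(X_n^2q(\varepsilon)-1)/p(\varepsilon)$, $a_2=p(\varepsilon)$, $a_3=(q(\varepsilon)-1)/p(\varepsilon)$, and $p(\varepsilon)q(\varepsilon)>0$. Conversely, if $\varepsilon\in RE_n^-$ satisfies $p(\varepsilon)\mid X_n^2q(\varepsilon)-1$ and $p(\varepsilon)\mid q(\varepsilon)-1$ in $\mathbb{Z}[X_{n-1}]$ and $p(\varepsilon)q(\varepsilon)>0$, then $$X_n=\left[\overline{\frac{X_n^2q(\varepsilon)-1}{p(\varepsilon)},\,p(\varepsilon),\,\frac{q(\varepsilon)-1}{p(\varepsilon)}}\right].$$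
   Context: For $m\geq 0$ let $X_m=2\cos(2\pi/2^{m+2})$ (so $X_0=0$ and $X_m=\sqrt{2+X_{m-1}}$), viewed as real numbers; $\mathbb{Z}[X_m]$ is the ring of integers of $\mathbb{Q}(X_m)$. Every $x\in\mathbb{Z}[X_n]$ can be written uniquely as $x=p(x)+X_nq(x)$ with $p(x),q(x)\in\mathbb{Z}[X_{n-1}]$. The relative norm is $N_{n/n-1}(x)=p(x)^2-X_n^2q(x)^2$, and $RE_n^-=\{\varepsilon\in\mathbb{Z}[X_n]: N_{n/n-1}(\varepsilon)=-1\}$. For a sequence $c_0,c_1,\dots$ in $\mathbb{Z}[X_{n-1}]$ define $p_k,q_k$ by $\begin{pmatrix}p_k & p_{k-1}\\ q_k & q_{k-1}\end{pmatrix}=\begin{pmatrix}c_0&1\\1&0\end{pmatrix}\cdots\begin{pmatrix}c_k&1\\1&0\end{pmatrix}$; $[c_0,c_1,\dots]$ denotes the real limit of $p_k/q_k$, and "$X_n=[c_0,c_1,\dots]$" means this limit exists and equals $X_n$. The notation $[\overline{c_1,c_2,c_3}]$ means the sequence $c_1,c_2,c_3,c_1,c_2,c_3,\dots$; a periodic sequence has type $(N,\ell)$ if $N\geq0$, $\ell\geq1$ are minimal with $c_{k+\ell}=c_k$ for all $k\geq N$. -}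

module Defs where

open import Data.Nat using (ℕ; zero; suc; _≤_; _%_)
open import Data.Integer as ℤ using (ℤ; +_; -[1+_])
open import Data.Product using (_×_; _,_; ∃-syntax; proj₁; proj₂)
open import Relation.Binary.PropositionalEquality using (_≡_; _≢_)

-- The rings ℤ[X_n], X_n = 2cos(2π/2^(n+2)), X_0 = 0, X_n² = 2 + X_{n-1}.
-- ℤ[X_0] = ℤ ; an element of ℤ[X_{n+1}] is a pair (p , q) of elements
-- of ℤ[X_n] standing for p + X_{n+1} q  (the unique decomposition).

ZX : ℕ → Set
ZX zero    = ℤ
ZX (suc n) = ZX n × ZX n

fromℤ : ∀ n → ℤ → ZX n
fromℤ zero    k = k
fromℤ (suc n) k = fromℤ n k , fromℤ n (+ 0)

0# 1# : ∀ n → ZX n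
0# n = fromℤ n (+ 0)
1# n = fromℤ n (+ 1)

add : ∀ n → ZX n → ZX n → ZX n
add zero    x y = x ℤ.+ y
add (suc n) (a , b) (c , d) = add n a c , add n b d

neg : ∀ n → ZX n → ZX n
neg zero    x = ℤ.- x
neg (suc n) (a , b) = neg n a , neg n b

sub : ∀ n → ZX n → ZX n → ZX n
sub n x y = add n x (neg n y)

gen : ∀ n → ZX n
gen zero    = + 0
gen (suc n) = 0# n , 1# n

-- X_{n+1}² = 2 + X_n, as an element of ℤ[X_n]
genSq : ∀ n → ZX n
genSq n = add n (fromℤ n (+ 2)) (gen n)

mul : ∀ n → ZX n → ZX n → ZX n
mul zero    x y = x ℤ.* y
mul (suc n) (a , b) (c , d) =
  add n (mul n a c) (mul n (mul n b d) (genSq n)) ,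
  add n (mul n a d) (mul n b c)

emb : ∀ n → ZX n → ZX (suc n)
emb n a = a , 0# n

-- The real order on ℤ[X_n] (as a subring of ℝ), computed through the
-- sign of a real number p + X q, using X_{n+1} > 0:
-- if sign p, sign q disagree, sign (p + X q) = ± sign (p² - X² q²).

data Sgn : Set where
  negative zer positive : Sgn

flip : Sgn → Sgn
flip negative = positive
flip zer      = zer
flip positive = negative

combine : Sgn → Sgn → Sgn → Sgn
combine zer      s        _ = s
combine positive zer      _ = positive
combine positive positive _ = positive
combine positive negative d = d
combine negative zer      _ = negative
combine negative negative _ = negative
combine negative positive d = flip d

signℤ : ℤ → Sgn
signℤ (+ zero)  = zer
signℤ (+ suc _) = positive
signℤ -[1+ _ ]  = negative

sign : ∀ n → ZX n → Sgn
sign zero    x = signℤ x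
sign (suc n) (a , b) =
  combine (sign n a) (sign n b)
          (sign n (sub n (mul n a a) (mul n (mul n b b) (genSq n))))

Pos : ∀ n → ZX n → Set
Pos n x = sign n x ≡ positive

Lt : ∀ n → ZX n → ZX n → Set
Lt n x y = Pos n (sub n y x)

abs : ∀ n → ZX n → ZX n
abs n x with sign n x
... | negative = neg n x
... | zer      = x
... | positive = x

Divides : ∀ n → ZX n → ZX n → Set
Divides n a b = ∃[ c ] mul n a c ≡ b

-- Relative norm and RE_n^-  (here n = suc m, base ring ℤ[X_m]).
-- For ε = (p , q) ∈ ℤ[X_{m+1}] : p(ε) = proj₁ ε, q(ε) = proj₂ ε.

pe qe : ∀ m → ZX (suc m) → ZX m
pe m ε = proj₁ ε
qe m ε = proj₂ ε

relNorm : ∀ m → ZX (suc m) → ZX m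
relNorm m (p , q) = sub m (mul m p p) (mul m (genSq m) (mul m q q))

RE⁻ : ∀ m → ZX (suc m) → Set
RE⁻ m ε = relNorm m ε ≡ neg m (1# m)

record Mat (A : Set) : Set where
  constructor mat
  field
    m11 m12 m21 m22 : A
open Mat public

matMul : ∀ n → Mat (ZX n) → Mat (ZX n) → Mat (ZX n)
matMul n (mat a b c d) (mat e f g h) =
  mat (add n (mul n a e) (mul n b g)) (add n (mul n a f) (mul n b h))
      (add n (mul n c e) (mul n d g)) (add n (mul n c f) (mul n d h))

step : ∀ n → ZX n → Mat (ZX n)
step n c = mat c (1# n) (1# n) (0# n)

convMat : ∀ n → (ℕ → ZX n) → ℕ → Mat (ZX n)
convMat n c zero    = step n (c zero)
convMat n c (suc k) = matMul n (convMat n c k) (step n (c (suc k)))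

pconv qconv : ∀ n → (ℕ → ZX n) → ℕ → ZX n
pconv n c k = m11 (convMat n c k)
qconv n c k = m21 (convMat n c k)

-- "X_{m+1} = [c_0, c_1, …]": p_k/q_k → X_{m+1} in ℝ, i.e. for every
-- j there is K such that for k ≥ K, q_k ≠ 0 and
-- |p_k/q_k - X_{m+1}| < 1/(j+1), i.e. (j+1)|p_k - X_{m+1} q_k| < |q_k|,
-- the inequality being taken in ℤ[X_{m+1}] ⊆ ℝ.
CFEqualsX : ∀ m → (ℕ → ZX m) → Set
CFEqualsX m c =
  ∀ (j : ℕ) → ∃[ K ] ∀ (k : ℕ) → K ≤ k →
    (qconv m c k ≢ 0# m) ×
    Lt (suc m)
       (mul (suc m) (fromℤ (suc m) (+ suc j))
            (abs (suc m) (sub (suc m) (emb m (pconv m c k))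
                                       (mul (suc m) (gen (suc m)) (emb m (qconv m c k))))))
       (abs (suc m) (emb m (qconv m c k)))

cyc3 : ∀ {A : Set} → A → A → A → ℕ → A
cyc3 a1 a2 a3 k with k % 3
... | 0 = a1
... | 1 = a2
... | _ = a3

PeriodicFrom : ∀ {A : Set} → (ℕ → A) → ℕ → ℕ → Set
PeriodicFrom c N ℓ = ∀ k → N ≤ k → c (k Data.Nat.+ ℓ) ≡ c k

HasType : ∀ {A : Set} → (ℕ → A) → ℕ → ℕ → Set
HasType c N ℓ =
  1 ≤ ℓ × PeriodicFrom c N ℓ ×
  (∀ N' ℓ' → 1 ≤ ℓ' → PeriodicFrom c N' ℓ' → N ≤ N' × ℓ ≤ ℓ')

{-# OPTIONS --safe #-}
-- ℤ[X_{n+1}] = ℤ[X_n][X_{n+1}] with X_{n+1}² = 2 + X_n, and the sign of a + b X_{n+1} is decided from the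
-- signs of a, b and of the norm a² - b²(2 + X_n). By induction on n this sign makes ℤ[X_n] an ordered
-- ring, using that 2 + X_n is not a square (its norm to ℤ is 2 and √2 is irrational); it is moreover
-- Archimedean, because every nonzero element divides a nonzero integer and is bounded by an integer.
--
-- For the 3-periodic expansion, (P_{k+3}, Q_{k+3}) = M (P_k, Q_k) with M = ∏ᵢ (aᵢ 1; 1 0) of
-- determinant -1. Put e_k = P_k - X Q_k and f_k = P_k + X Q_k. Convergence means e_k = o(Q_k); comparing
-- e_{k+3} with e_k then forces M = [[p, X² q], [q, p]], so f_{k+3} = ε f_k and e_{k+3} = ε̄ e_k for
-- ε = p + X q, whose relative norm is det M = -1. Since |ε|² - |ε̄|² = 4 X p q and |ε||ε̄| = 1, the
-- sign of pq decides whether |e_k| decays and |f_k| grows, which is what convergence requires; conversely,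
-- if pq > 0 then |e_k| decays geometrically against |Q_k|.
module Submission where

open import Defs
open import Level using (0ℓ)
open import Data.Nat as ℕ using (ℕ; zero; suc)
import Data.Nat.Properties as ℕₚ
open import Data.Nat.Induction using (<-rec)
import Data.Nat.Solver
open import Data.Integer as ℤ using (ℤ; +_; -[1+_])
import Data.Integer.Properties as ℤₚ
open import Data.Product using (_×_; _,_; ∃-syntax; proj₁; proj₂; map₂)
open import Data.Sum using (_⊎_; inj₁; inj₂; [_,_]′)
open import Data.Empty using (⊥; ⊥-elim)
open import Data.Maybe using (Maybe; just; nothing)
open import Relation.Nullary using (yes; no)
open import Relation.Binary.PropositionalEquality
open import Function using (_∘_; id)
open import Algebra.Bundles using (CommutativeRing)
open import Relation.Binary.Structures using (IsPreorder)
import Relation.Binary.Reasoning.Base.Triple as Triple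
open import Algebra.Solver.Ring.AlmostCommutativeRing
  using (fromCommutativeRing; _-Raw-AlmostCommutative⟶_)
import Algebra.Solver.Ring


record RingLaws (n : ℕ) : Set where
  field
    +-assoc     : ∀ x y z → add n (add n x y) z ≡ add n x (add n y z)
    +-comm      : ∀ x y → add n x y ≡ add n y x
    +-identityˡ : ∀ x → add n (0# n) x ≡ x
    -‿inverseˡ  : ∀ x → add n (neg n x) x ≡ 0# n
    *-assoc     : ∀ x y z → mul n (mul n x y) z ≡ mul n x (mul n y z)
    *-comm      : ∀ x y → mul n x y ≡ mul n y x
    *-identityˡ : ∀ x → mul n (1# n) x ≡ x
    distribʳ    : ∀ x y z → mul n (add n y z) x ≡ add n (mul n y x) (mul n z x)
    fromℤ-+     : ∀ a b → fromℤ n (a ℤ.+ b) ≡ add n (fromℤ n a) (fromℤ n b)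
    fromℤ-*     : ∀ a b → fromℤ n (a ℤ.* b) ≡ mul n (fromℤ n a) (fromℤ n b)
    fromℤ-neg   : ∀ a → fromℤ n (ℤ.- a) ≡ neg n (fromℤ n a)

module _ {n : ℕ} (R : RingLaws n) where
  open RingLaws R

  commutativeRing : CommutativeRing 0ℓ 0ℓ
  commutativeRing = record
    { Carrier = ZX n ; _≈_ = _≡_ ; _+_ = add n ; _*_ = mul n ; -_ = neg n
    ; 0# = 0# n ; 1# = 1# n
    ; isCommutativeRing = record
      { isRing = record
        { +-isAbelianGroup = record
          { isGroup = record
            { isMonoid = record
              { isSemigroup = record
                { isMagma = record { isEquivalence = isEquivalence ; ∙-cong = cong₂ (add n) }
                ; assoc = +-assoc }
              ; identity = +-identityˡ , λ x → trans (+-comm x _) (+-identityˡ x) }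
            ; inverse = -‿inverseˡ , λ x → trans (+-comm x _) (-‿inverseˡ x)
            ; ⁻¹-cong = cong (neg n) }
          ; comm = +-comm }
        ; *-cong = cong₂ (mul n)
        ; *-assoc = *-assoc
        ; *-identity = *-identityˡ , λ x → trans (*-comm x _) (*-identityˡ x)
        ; distrib = (λ x y z → trans (*-comm x _) (trans (distribʳ x y z)
                                 (cong₂ (add n) (*-comm y x) (*-comm z x))))
                  , distribʳ }
      ; *-comm = *-comm } }

  fromℤ-morphism : CommutativeRing.rawRing ℤₚ.+-*-commutativeRing
                     -Raw-AlmostCommutative⟶ fromCommutativeRing commutativeRing
  fromℤ-morphism = record
    { ⟦_⟧ = fromℤ n ; +-homo = fromℤ-+ ; *-homo = fromℤ-* ; -‿homo = fromℤ-neg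
    ; 0-homo = refl ; 1-homo = refl }

  fromℤ-≟ : ∀ a b → Maybe (fromℤ n a ≡ fromℤ n b)
  fromℤ-≟ a b with a ℤ.≟ b
  ... | yes a≡b = just (cong (fromℤ n) a≡b)
  ... | no _    = nothing

  module RingSolver = Algebra.Solver.Ring
    (CommutativeRing.rawRing ℤₚ.+-*-commutativeRing) (fromCommutativeRing commutativeRing)
    fromℤ-morphism fromℤ-≟

ringLaws-suc : ∀ {n} → RingLaws n → RingLaws (suc n)
ringLaws-suc {n} R = record
  { +-assoc = λ { (a , b) (c , d) (e , f) → cong₂ _,_ (+-assoc a c e) (+-assoc b d f) }
  ; +-comm = λ { (a , b) (c , d) → cong₂ _,_ (+-comm a c) (+-comm b d) }
  ; +-identityˡ = λ { (a , b) → cong₂ _,_ (+-identityˡ a) (+-identityˡ b) }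
  ; -‿inverseˡ = λ { (a , b) → cong₂ _,_ (-‿inverseˡ a) (-‿inverseˡ b) }
  ; *-assoc = λ { (a , b) (c , d) (e , f) → cong₂ _,_
      (solve 7 (λ a b c d e f g → (a :* c :+ b :* d :* g) :* e :+ (a :* d :+ b :* c) :* f :* g
                               := a :* (c :* e :+ d :* f :* g) :+ b :* (c :* f :+ d :* e) :* g)
             refl a b c d e f (genSq n))
      (solve 7 (λ a b c d e f g → (a :* c :+ b :* d :* g) :* f :+ (a :* d :+ b :* c) :* e
                               := a :* (c :* f :+ d :* e) :+ b :* (c :* e :+ d :* f :* g))
             refl a b c d e f (genSq n)) }
  ; *-comm = λ { (a , b) (c , d) → cong₂ _,_
      (solve 5 (λ a b c d g → a :* c :+ b :* d :* g := c :* a :+ d :* b :* g) refl a b c d (genSq n))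
      (solve 4 (λ a b c d → a :* d :+ b :* c := c :* b :+ d :* a) refl a b c d) }
  ; *-identityˡ = λ { (a , b) → cong₂ _,_
      (solve 3 (λ a b g → con (+ 1) :* a :+ con (+ 0) :* b :* g := a) refl a b (genSq n))
      (solve 2 (λ a b → con (+ 1) :* b :+ con (+ 0) :* a := b) refl a b) }
  ; distribʳ = λ { (a , b) (c , d) (e , f) → cong₂ _,_
      (solve 7 (λ a b c d e f g → (c :+ e) :* a :+ (d :+ f) :* b :* g
                               := (c :* a :+ d :* b :* g) :+ (e :* a :+ f :* b :* g))
             refl a b c d e f (genSq n))
      (solve 6 (λ a b c d e f → (c :+ e) :* b :+ (d :+ f) :* a
                             := (c :* b :+ d :* a) :+ (e :* b :+ f :* a))
             refl a b c d e f) }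
  ; fromℤ-+ = λ a b → cong₂ _,_ (fromℤ-+ a b) (fromℤ-+ (+ 0) (+ 0))
  ; fromℤ-* = λ a b → cong₂ _,_
      (trans (fromℤ-* a b)
             (solve 3 (λ x y g → x :* y := x :* y :+ con (+ 0) :* con (+ 0) :* g)
                    refl (fromℤ n a) (fromℤ n b) (genSq n)))
      (solve 2 (λ x y → con (+ 0) := x :* con (+ 0) :+ con (+ 0) :* y) refl (fromℤ n a) (fromℤ n b))
  ; fromℤ-neg = λ a → cong₂ _,_ (fromℤ-neg a) (solve 0 (con (+ 0) := :- con (+ 0)) refl)
  }
  where open RingLaws R
        open RingSolver R

ringLaws : ∀ n → RingLaws n
ringLaws zero = record
  { +-assoc = ℤₚ.+-assoc ; +-comm = ℤₚ.+-comm ; +-identityˡ = ℤₚ.+-identityˡ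
  ; -‿inverseˡ = ℤₚ.+-inverseˡ ; *-assoc = ℤₚ.*-assoc ; *-comm = ℤₚ.*-comm
  ; *-identityˡ = ℤₚ.*-identityˡ ; distribʳ = ℤₚ.*-distribʳ-+
  ; fromℤ-+ = λ _ _ → refl ; fromℤ-* = λ _ _ → refl ; fromℤ-neg = λ _ → refl }
ringLaws (suc n) = ringLaws-suc (ringLaws n)

module Solver (n : ℕ) = RingSolver (ringLaws n)

infixl 7 _*ˢ_

_*ˢ_ : Sgn → Sgn → Sgn
zer      *ˢ _ = zer
positive *ˢ t = t
negative *ˢ t = flip t

-- The sign of a + b X_{n+1} is that of a when a² > b² X_{n+1}², and that of b when a² < b² X_{n+1}².
dominant : Sgn → Sgn → Sgn → Sgn
dominant positive s _ = s
dominant zer      _ _ = zer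
dominant negative _ t = t

flip-involutive : ∀ s → flip (flip s) ≡ s
flip-involutive zer      = refl
flip-involutive positive = refl
flip-involutive negative = refl

*ˢ-identityʳ : ∀ s → s *ˢ positive ≡ s
*ˢ-identityʳ zer      = refl
*ˢ-identityʳ positive = refl
*ˢ-identityʳ negative = refl

*ˢ-zeroʳ : ∀ s → s *ˢ zer ≡ zer
*ˢ-zeroʳ zer      = refl
*ˢ-zeroʳ positive = refl
*ˢ-zeroʳ negative = refl

*ˢ≡positive : ∀ s t → s *ˢ t ≡ positive →
              (s ≡ positive × t ≡ positive) ⊎ (s ≡ negative × t ≡ negative)
*ˢ≡positive positive positive _ = inj₁ (refl , refl)
*ˢ≡positive negative negative _ = inj₂ (refl , refl)
*ˢ≡positive zer      _        ()
*ˢ≡positive positive zer      ()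
*ˢ≡positive positive negative ()
*ˢ≡positive negative zer      ()
*ˢ≡positive negative positive ()

*ˢ≡zer : ∀ s t → s *ˢ t ≡ zer → s ≡ zer ⊎ t ≡ zer
*ˢ≡zer zer      _   _ = inj₁ refl
*ˢ≡zer positive zer _ = inj₂ refl
*ˢ≡zer negative zer _ = inj₂ refl
*ˢ≡zer positive positive ()
*ˢ≡zer positive negative ()
*ˢ≡zer negative positive ()
*ˢ≡zer negative negative ()

*ˢ-self≢negative : ∀ s → s *ˢ s ≢ negative
*ˢ-self≢negative zer      ()
*ˢ-self≢negative positive ()
*ˢ-self≢negative negative ()

*ˢ-self≡zer : ∀ s → s *ˢ s ≡ zer → s ≡ zer
*ˢ-self≡zer zer      _ = refl
*ˢ-self≡zer positive ()
*ˢ-self≡zer negative ()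

*ˢ-negative≡negative : ∀ s → s *ˢ negative ≡ negative → s ≡ positive
*ˢ-negative≡negative positive _ = refl
*ˢ-negative≡negative zer      ()
*ˢ-negative≡negative negative ()

dominant-flip : ∀ s a b → dominant s (flip a) (flip b) ≡ flip (dominant s a b)
dominant-flip positive _ _ = refl
dominant-flip zer      _ _ = refl
dominant-flip negative _ _ = refl

record SignLaws (n : ℕ) : Set where
  field
    sign-fromℤ  : ∀ a → sign n (fromℤ n a) ≡ signℤ a
    sign-zer⇒≡0 : ∀ x → sign n x ≡ zer → x ≡ 0# n
    sign-neg    : ∀ x → sign n (neg n x) ≡ flip (sign n x)
    sign-mul    : ∀ x y → sign n (mul n x y) ≡ sign n x *ˢ sign n y
    pos-add     : ∀ x y → Pos n x → Pos n y → Pos n (add n x y)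

signLaws-ℤ : SignLaws zero
signLaws-ℤ = record
  { sign-fromℤ = λ _ → refl ; sign-zer⇒≡0 = zer⇒≡0 ; sign-neg = neg-flip
  ; sign-mul = mul-*ˢ ; pos-add = add-pos }
  where
  zer⇒≡0 : ∀ x → signℤ x ≡ zer → x ≡ + 0
  zer⇒≡0 (+ zero)  _ = refl
  zer⇒≡0 (+ suc _) ()
  zer⇒≡0 -[1+ _ ]  ()
  neg-flip : ∀ x → signℤ (ℤ.- x) ≡ flip (signℤ x)
  neg-flip (+ zero)  = refl
  neg-flip (+ suc _) = refl
  neg-flip -[1+ _ ]  = refl
  mul-*ˢ : ∀ x y → signℤ (x ℤ.* y) ≡ signℤ x *ˢ signℤ y
  mul-*ˢ (+ zero)  y         = refl
  mul-*ˢ (+ suc a) (+ zero)  = cong signℤ (ℤₚ.*-zeroʳ (+ suc a))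
  mul-*ˢ -[1+ a ]  (+ zero)  = cong signℤ (ℤₚ.*-zeroʳ -[1+ a ])
  mul-*ˢ (+ suc a) (+ suc b) = refl
  mul-*ˢ (+ suc a) -[1+ b ]  = refl
  mul-*ˢ -[1+ a ]  (+ suc b) = refl
  mul-*ˢ -[1+ a ]  -[1+ b ]  = refl
  add-pos : ∀ x y → signℤ x ≡ positive → signℤ y ≡ positive → signℤ (x ℤ.+ y) ≡ positive
  add-pos (+ suc a) (+ suc b) _ _ = refl
  add-pos (+ zero)  _         ()
  add-pos -[1+ _ ]  _         ()
  add-pos (+ suc a) (+ zero)  _ ()
  add-pos (+ suc a) -[1+ _ ]  _ ()

module OrderedRing {n : ℕ} (O : SignLaws n) where
  open SignLaws O public
  open RingLaws (ringLaws n) public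
  open Solver n public

  infixl 6 _+_ _-_
  infixl 7 _*_
  infix  8 -_
  infix  4 _<_ _≤_

  _+_ _-_ _*_ : ZX n → ZX n → ZX n
  _+_ = add n
  _-_ = sub n
  _*_ = mul n

  -_ ∣_∣ : ZX n → ZX n
  -_  = neg n
  ∣_∣ = abs n

  𝟘 𝟙 : ZX n
  𝟘 = 0# n
  𝟙 = 1# n

  ι : ℕ → ZX n
  ι k = fromℤ n (+ k)

  Positive NonNeg Negative : ZX n → Set
  Positive   = Pos n
  NonNeg x   = sign n x ≢ negative
  Negative x = sign n x ≡ negative

  _<_ _≤_ : ZX n → ZX n → Set
  _<_   = Lt n
  x ≤ y = NonNeg (y - x)

  +-identityʳ : ∀ x → x + 𝟘 ≡ x
  +-identityʳ x = trans (+-comm x _) (+-identityˡ x)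

  sub-telescope : ∀ a b c → (c - b) + (b - a) ≡ c - a
  sub-telescope = solve 3 (λ a b c → (c :- b) :+ (b :- a) := c :- a) refl

  x-y≡𝟘⇒x≡y : ∀ {x y} → x - y ≡ 𝟘 → x ≡ y
  x-y≡𝟘⇒x≡y {x} {y} e = begin
    x             ≡⟨ solve 2 (λ x y → x := (x :- y) :+ y) refl x y ⟩
    (x - y) + y   ≡⟨ cong (_+ y) e ⟩
    𝟘 + y         ≡⟨ +-identityˡ y ⟩
    y             ∎
    where open ≡-Reasoning

  sign-𝟘 : sign n 𝟘 ≡ zer
  sign-𝟘 = sign-fromℤ (+ 0)

  𝟙-pos : Positive 𝟙
  𝟙-pos = sign-fromℤ (+ 1)

  ≡𝟘⇒sign-zer : ∀ {x} → x ≡ 𝟘 → sign n x ≡ zer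
  ≡𝟘⇒sign-zer refl = sign-𝟘

  sign≡⇒nonNeg : ∀ {x s} → sign n x ≡ s → s ≢ negative → NonNeg x
  sign≡⇒nonNeg sx s≢neg e = s≢neg (trans (sym sx) e)

  pos⇒nonNeg : ∀ {x} → Positive x → NonNeg x
  pos⇒nonNeg p = sign≡⇒nonNeg p λ ()

  pos⇒≢𝟘 : ∀ {x} → Positive x → x ≢ 𝟘
  pos⇒≢𝟘 p e with trans (sym p) (≡𝟘⇒sign-zer e)
  ... | ()

  neg⇒≢𝟘 : ∀ {x} → Negative x → x ≢ 𝟘
  neg⇒≢𝟘 nx e with trans (sym nx) (≡𝟘⇒sign-zer e)
  ... | ()

  nonNeg⇒𝟘≤ : ∀ {x} → NonNeg x → 𝟘 ≤ x
  nonNeg⇒𝟘≤ {x} = subst NonNeg (solve 1 (λ x → x := x :- con (+ 0)) refl x)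

  𝟙≢𝟘 : 𝟙 ≢ 𝟘
  𝟙≢𝟘 = pos⇒≢𝟘 𝟙-pos

  nonNeg-𝟘 : NonNeg 𝟘
  nonNeg-𝟘 = sign≡⇒nonNeg sign-𝟘 λ ()

  nonNeg⇒pos⊎≡𝟘 : ∀ {x} → NonNeg x → Positive x ⊎ x ≡ 𝟘
  nonNeg⇒pos⊎≡𝟘 {x} nx with sign n x in eq
  ... | positive = inj₁ refl
  ... | zer      = inj₂ (sign-zer⇒≡0 x eq)
  ... | negative = ⊥-elim (nx refl)

  pos⊎≡𝟘⊎neg : ∀ x → Positive x ⊎ x ≡ 𝟘 ⊎ Negative x
  pos⊎≡𝟘⊎neg x with sign n x in eq
  ... | positive = inj₁ refl
  ... | zer      = inj₂ (inj₁ (sign-zer⇒≡0 x eq))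
  ... | negative = inj₂ (inj₂ refl)

  ≢𝟘⇒pos⊎neg : ∀ {x} → x ≢ 𝟘 → Positive x ⊎ Negative x
  ≢𝟘⇒pos⊎neg {x} x≢𝟘 with sign n x in eq
  ... | positive = inj₁ refl
  ... | zer      = ⊥-elim (x≢𝟘 (sign-zer⇒≡0 x eq))
  ... | negative = inj₂ refl

  pos⇒¬neg : ∀ {x} → Positive x → Negative x → ⊥
  pos⇒¬neg px nx with trans (sym px) nx
  ... | ()

  neg⇒-pos : ∀ {x} → Negative x → Positive (- x)
  neg⇒-pos {x} nx = trans (sign-neg x) (cong flip nx)

  pos⇒-neg : ∀ {x} → Positive x → Negative (- x)
  pos⇒-neg {x} px = trans (sign-neg x) (cong flip px)

  -pos⇒neg : ∀ {x} → Positive (- x) → Negative x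
  -pos⇒neg {x} p = trans (sym (flip-involutive _)) (cong flip (trans (sym (sign-neg x)) p))

  pos⊎-nonNeg : ∀ x → Positive x ⊎ NonNeg (- x)
  pos⊎-nonNeg x with sign n x in eq
  ... | positive = inj₁ refl
  ... | zer      = inj₂ (sign≡⇒nonNeg (trans (sign-neg x) (cong flip eq)) λ ())
  ... | negative = inj₂ (sign≡⇒nonNeg (trans (sign-neg x) (cong flip eq)) λ ())

  square-nonNeg : ∀ x → NonNeg (x * x)
  square-nonNeg x e = *ˢ-self≢negative (sign n x) (trans (sym (sign-mul x x)) e)

  pos+nonNeg : ∀ {x y} → Positive x → NonNeg y → Positive (x + y)
  pos+nonNeg {x} {y} px ny with nonNeg⇒pos⊎≡𝟘 ny
  ... | inj₁ py   = pos-add x y px py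
  ... | inj₂ refl = subst Positive (sym (+-identityʳ x)) px

  nonNeg+pos : ∀ {x y} → NonNeg x → Positive y → Positive (x + y)
  nonNeg+pos {x} {y} nx py = subst Positive (+-comm y x) (pos+nonNeg py nx)

  nonNeg+nonNeg : ∀ {x y} → NonNeg x → NonNeg y → NonNeg (x + y)
  nonNeg+nonNeg {x} {y} nx ny with nonNeg⇒pos⊎≡𝟘 nx
  ... | inj₁ px   = pos⇒nonNeg (pos+nonNeg px ny)
  ... | inj₂ refl = subst NonNeg (sym (+-identityˡ y)) ny

  neg+neg : ∀ {x y} → Negative x → Negative y → Negative (x + y)
  neg+neg {x} {y} nx ny = -pos⇒neg (subst Positive (solve 2 (λ x y → :- x :+ :- y := :- (x :+ y)) refl x y)
                                                  (pos-add _ _ (neg⇒-pos nx) (neg⇒-pos ny)))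

  sign-pos* : ∀ {x} y → Positive x → sign n (x * y) ≡ sign n y
  sign-pos* {x} y px = trans (sign-mul x y) (cong (_*ˢ sign n y) px)

  pos*pos : ∀ {x y} → Positive x → Positive y → Positive (x * y)
  pos*pos {x} {y} px py = trans (sign-pos* y px) py

  nonNeg*nonNeg : ∀ {x y} → NonNeg x → NonNeg y → NonNeg (x * y)
  nonNeg*nonNeg {x} {y} nx ny with nonNeg⇒pos⊎≡𝟘 nx
  ... | inj₁ px   = subst (_≢ negative) (sym (sign-pos* y px)) ny
  ... | inj₂ refl = subst NonNeg (solve 1 (λ y → con (+ 0) := con (+ 0) :* y) refl y) nonNeg-𝟘

  *-integral : ∀ x y → x * y ≡ 𝟘 → x ≡ 𝟘 ⊎ y ≡ 𝟘
  *-integral x y e with *ˢ≡zer (sign n x) (sign n y) (trans (sym (sign-mul x y)) (≡𝟘⇒sign-zer e))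
  ... | inj₁ sx = inj₁ (sign-zer⇒≡0 x sx)
  ... | inj₂ sy = inj₂ (sign-zer⇒≡0 y sy)

  sign-sum+diff : ∀ u v → sign n ((u + v) + (u - v)) ≡ sign n u
  sign-sum+diff u v = trans (cong (sign n) (solve 2 (λ u v → (u :+ v) :+ (u :- v) := con (+ 2) :* u) refl u v))
                            (sign-pos* u (sign-fromℤ (+ 2)))

  sign-+-dominant : ∀ u v → Positive (u * u - v * v) → sign n (u + v) ≡ sign n u
  sign-+-dominant u v h
    with *ˢ≡positive (sign n (u + v)) (sign n (u - v))
           (trans (sym (sign-mul (u + v) (u - v)))
                  (subst Positive (solve 2 (λ u v → u :* u :- v :* v := (u :+ v) :* (u :- v)) refl u v) h))
  ... | inj₁ (p , q) = trans p (trans (sym (pos-add _ _ p q)) (sign-sum+diff u v))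
  ... | inj₂ (p , q) = trans p (trans (sym (neg+neg p q)) (sign-sum+diff u v))

  <-trans : ∀ {a b c} → a < b → b < c → a < c
  <-trans {a} {b} {c} a<b b<c = subst Positive (sub-telescope a b c) (pos-add _ _ b<c a<b)

  ≤-<-trans : ∀ {a b c} → a ≤ b → b < c → a < c
  ≤-<-trans {a} {b} {c} a≤b b<c = subst Positive (sub-telescope a b c) (pos+nonNeg b<c a≤b)

  <-≤-trans : ∀ {a b c} → a < b → b ≤ c → a < c
  <-≤-trans {a} {b} {c} a<b b≤c = subst Positive (sub-telescope a b c) (nonNeg+pos b≤c a<b)

  ≤-trans : ∀ {a b c} → a ≤ b → b ≤ c → a ≤ c
  ≤-trans {a} {b} {c} a≤b b≤c = subst NonNeg (sub-telescope a b c) (nonNeg+nonNeg b≤c a≤b)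

  <⇒≤ : ∀ {a b} → a < b → a ≤ b
  <⇒≤ = pos⇒nonNeg

  ≤-reflexive : ∀ {a b} → a ≡ b → a ≤ b
  ≤-reflexive {a} refl = subst NonNeg (solve 1 (λ a → con (+ 0) := a :- a) refl a) nonNeg-𝟘

  ≤-refl : ∀ {a} → a ≤ a
  ≤-refl = ≤-reflexive refl

  ≤⇒≯ : ∀ {a b} → b ≤ a → a < b → ⊥
  ≤⇒≯ {a} {b} b≤a a<b with trans (sym (pos+nonNeg a<b b≤a))
                               (≡𝟘⇒sign-zer (solve 2 (λ a b → (b :- a) :+ (a :- b) := con (+ 0)) refl a b))
  ... | ()

  sign-sub-swap : ∀ a b → sign n (a - b) ≡ flip (sign n (b - a))
  sign-sub-swap a b = trans (cong (sign n) (solve 2 (λ a b → a :- b := :- (b :- a)) refl a b)) (sign-neg _)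

  <⊎≥ : ∀ a b → a < b ⊎ b ≤ a
  <⊎≥ a b with sign n (b - a) in eq
  ... | positive = inj₁ refl
  ... | zer      = inj₂ (sign≡⇒nonNeg (trans (sign-sub-swap a b) (cong flip eq)) λ ())
  ... | negative = inj₂ (sign≡⇒nonNeg (trans (sign-sub-swap a b) (cong flip eq)) λ ())

  +-mono-<-≤ : ∀ {a b c d} → a < b → c ≤ d → a + c < b + d
  +-mono-<-≤ {a} {b} {c} {d} a<b c≤d =
    subst Positive (solve 4 (λ a b c d → (b :- a) :+ (d :- c) := (b :+ d) :- (a :+ c)) refl a b c d)
          (pos+nonNeg a<b c≤d)

  +-mono-≤ : ∀ {a b c d} → a ≤ b → c ≤ d → a + c ≤ b + d
  +-mono-≤ {a} {b} {c} {d} a≤b c≤d =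
    subst NonNeg (solve 4 (λ a b c d → (b :- a) :+ (d :- c) := (b :+ d) :- (a :+ c)) refl a b c d)
          (nonNeg+nonNeg a≤b c≤d)

  +-cancelˡ-< : ∀ {a b c} → a + b < a + c → b < c
  +-cancelˡ-< {a} {b} {c} = subst Positive (solve 3 (λ a b c → (a :+ c) :- (a :+ b) := c :- b) refl a b c)

  *-monoˡ-< : ∀ {c a b} → Positive c → a < b → c * a < c * b
  *-monoˡ-< {c} {a} {b} pc a<b =
    subst Positive (solve 3 (λ c a b → c :* (b :- a) := c :* b :- c :* a) refl c a b) (pos*pos pc a<b)

  *-monoˡ-≤ : ∀ {c a b} → NonNeg c → a ≤ b → c * a ≤ c * b
  *-monoˡ-≤ {c} {a} {b} nc a≤b =
    subst NonNeg (solve 3 (λ c a b → c :* (b :- a) := c :* b :- c :* a) refl c a b) (nonNeg*nonNeg nc a≤b)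

  *-monoʳ-≤ : ∀ {c a b} → NonNeg c → a ≤ b → a * c ≤ b * c
  *-monoʳ-≤ {c} {a} {b} nc a≤b = subst₂ _≤_ (*-comm c a) (*-comm c b) (*-monoˡ-≤ nc a≤b)

  *-cancelˡ-< : ∀ {c a b} → Positive c → c * a < c * b → a < b
  *-cancelˡ-< {c} {a} {b} pc h =
    trans (sym (sign-pos* (b - a) pc))
          (subst Positive (solve 3 (λ c a b → c :* b :- c :* a := c :* (b :- a)) refl c a b) h)

  *-mono-< : ∀ {x y z w} → y < x → NonNeg y → w < z → NonNeg w → y * w < x * z
  *-mono-< {x} {y} {z} {w} y<x ny w<z nw =
    subst Positive (solve 4 (λ x y z w → x :* (z :- w) :+ (x :- y) :* w := x :* z :- y :* w) refl x y z w)
          (pos+nonNeg (pos*pos px w<z) (nonNeg*nonNeg (pos⇒nonNeg y<x) nw))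
    where
    px : Positive x
    px = subst Positive (solve 2 (λ x y → (x :- y) :+ y := x) refl x y) (pos+nonNeg y<x ny)

  squares-<⇒< : ∀ u v → Positive (u * u - v * v) → Positive u → v < u
  squares-<⇒< u v h pu = trans (sign-+-dominant u (- v) h′) pu
    where
    h′ : Positive (u * u - (- v) * (- v))
    h′ = subst Positive (solve 2 (λ u v → u :* u :- v :* v := u :* u :- (:- v) :* (:- v)) refl u v) h

  squares-≤⇒≤ : ∀ {u v} → NonNeg u → NonNeg v → u * u ≤ v * v → u ≤ v
  squares-≤⇒≤ {u} {v} nu nv h with <⊎≥ v u
  ... | inj₁ v<u = ⊥-elim (≤⇒≯ h (*-mono-< v<u nv v<u nv))
  ... | inj₂ u≤v = u≤v

  ∣∣-cases : ∀ x → (NonNeg x × ∣ x ∣ ≡ x) ⊎ (Negative x × ∣ x ∣ ≡ - x)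
  ∣∣-cases x with sign n x in eq
  ... | zer      = inj₁ ((λ ()) , refl)
  ... | positive = inj₁ ((λ ()) , refl)
  ... | negative = inj₂ (refl , refl)

  ∣x∣-nonNeg : ∀ x → NonNeg ∣ x ∣
  ∣x∣-nonNeg x with ∣∣-cases x
  ... | inj₁ (nx , e) = subst NonNeg (sym e) nx
  ... | inj₂ (nx , e) = subst NonNeg (sym e) (pos⇒nonNeg (neg⇒-pos nx))

  ∣x∣-pos : ∀ {x} → x ≢ 𝟘 → Positive ∣ x ∣
  ∣x∣-pos {x} x≢𝟘 with ∣∣-cases x | ≢𝟘⇒pos⊎neg x≢𝟘
  ... | inj₁ (_ , e)  | inj₁ px = subst Positive (sym e) px
  ... | inj₁ (nx , _) | inj₂ ng = ⊥-elim (nx ng)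
  ... | inj₂ (ng , e) | _       = subst Positive (sym e) (neg⇒-pos ng)

  ∣x∣≡x : ∀ {x} → NonNeg x → ∣ x ∣ ≡ x
  ∣x∣≡x {x} nx with ∣∣-cases x
  ... | inj₁ (_ , e)  = e
  ... | inj₂ (ng , _) = ⊥-elim (nx ng)

  x≤∣x∣ : ∀ x → x ≤ ∣ x ∣
  x≤∣x∣ x with ∣∣-cases x
  ... | inj₁ (_ , e)  = ≤-reflexive (sym e)
  ... | inj₂ (ng , e) = subst NonNeg (cong (_- x) (sym e))
                          (subst NonNeg (solve 1 (λ x → :- x :+ :- x := :- x :- x) refl x)
                                 (pos⇒nonNeg (pos-add _ _ (neg⇒-pos ng) (neg⇒-pos ng))))

  ∣x∣²≡x² : ∀ x → ∣ x ∣ * ∣ x ∣ ≡ x * x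
  ∣x∣²≡x² x with ∣∣-cases x
  ... | inj₁ (_ , e) = cong₂ _*_ e e
  ... | inj₂ (_ , e) = trans (cong₂ _*_ e e) (solve 1 (λ x → (:- x) :* (:- x) := x :* x) refl x)

  squares-injective : ∀ {u v} → NonNeg u → NonNeg v → u * u ≡ v * v → u ≡ v
  squares-injective {u} {v} nu nv e = squares-≤-antisym (squares-≤⇒≤ nu nv (≤-reflexive e))
                                                        (squares-≤⇒≤ nv nu (≤-reflexive (sym e)))
    where
    squares-≤-antisym : u ≤ v → v ≤ u → u ≡ v
    squares-≤-antisym u≤v v≤u with nonNeg⇒pos⊎≡𝟘 u≤v
    ... | inj₁ u<v = ⊥-elim (≤⇒≯ v≤u u<v)
    ... | inj₂ v-u≡𝟘 = sym (x-y≡𝟘⇒x≡y v-u≡𝟘)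

  ∣-x∣≡∣x∣ : ∀ x → ∣ - x ∣ ≡ ∣ x ∣
  ∣-x∣≡∣x∣ x = squares-injective (∣x∣-nonNeg _) (∣x∣-nonNeg _)
    (trans (∣x∣²≡x² (- x)) (trans (solve 1 (λ x → (:- x) :* (:- x) := x :* x) refl x) (sym (∣x∣²≡x² x))))

  -x≤∣x∣ : ∀ x → - x ≤ ∣ x ∣
  -x≤∣x∣ x = subst (- x ≤_) (∣-x∣≡∣x∣ x) (x≤∣x∣ (- x))

  ∣x*y∣≡∣x∣*∣y∣ : ∀ x y → ∣ x * y ∣ ≡ ∣ x ∣ * ∣ y ∣
  ∣x*y∣≡∣x∣*∣y∣ x y = squares-injective (∣x∣-nonNeg _) (nonNeg*nonNeg (∣x∣-nonNeg x) (∣x∣-nonNeg y)) (begin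
    ∣ x * y ∣ * ∣ x * y ∣        ≡⟨ ∣x∣²≡x² (x * y) ⟩
    (x * y) * (x * y)            ≡⟨ solve 2 (λ x y → (x :* y) :* (x :* y) := (x :* x) :* (y :* y)) refl x y ⟩
    (x * x) * (y * y)            ≡⟨ sym (cong₂ _*_ (∣x∣²≡x² x) (∣x∣²≡x² y)) ⟩
    (∣ x ∣ * ∣ x ∣) * (∣ y ∣ * ∣ y ∣)
      ≡⟨ solve 2 (λ a b → (a :* a) :* (b :* b) := (a :* b) :* (a :* b)) refl ∣ x ∣ ∣ y ∣ ⟩
    (∣ x ∣ * ∣ y ∣) * (∣ x ∣ * ∣ y ∣) ∎)
    where open ≡-Reasoning

  ∣∣-≤ : ∀ {x c} → x ≤ c → - x ≤ c → ∣ x ∣ ≤ c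
  ∣∣-≤ {x} {c} h₁ h₂ with ∣∣-cases x
  ... | inj₁ (_ , e) = subst (_≤ c) (sym e) h₁
  ... | inj₂ (_ , e) = subst (_≤ c) (sym e) h₂

  ∣∣-< : ∀ {x c} → x < c → - x < c → ∣ x ∣ < c
  ∣∣-< {x} {c} h₁ h₂ with ∣∣-cases x
  ... | inj₁ (_ , e) = subst (_< c) (sym e) h₁
  ... | inj₂ (_ , e) = subst (_< c) (sym e) h₂

  ∣∣-triangle : ∀ x y → ∣ x + y ∣ ≤ ∣ x ∣ + ∣ y ∣
  ∣∣-triangle x y = ∣∣-≤ (+-mono-≤ (x≤∣x∣ x) (x≤∣x∣ y))
    (subst (_≤ ∣ x ∣ + ∣ y ∣) (solve 2 (λ x y → :- x :+ :- y := :- (x :+ y)) refl x y)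
           (+-mono-≤ (-x≤∣x∣ x) (-x≤∣x∣ y)))

  ι-nonNeg : ∀ k → NonNeg (ι k)
  ι-nonNeg k = sign≡⇒nonNeg (sign-fromℤ (+ k)) (signℤ-+ k)
    where
    signℤ-+ : ∀ k → signℤ (+ k) ≢ negative
    signℤ-+ zero    ()
    signℤ-+ (suc k) ()

  ι-+ : ∀ a b → ι (a ℕ.+ b) ≡ ι a + ι b
  ι-+ a b = fromℤ-+ (+ a) (+ b)

  ι-* : ∀ a b → ι (a ℕ.* b) ≡ ι a * ι b
  ι-* a b = trans (cong (fromℤ n) (ℤₚ.pos-* a b)) (fromℤ-* (+ a) (+ b))

  ι-mono-≤ : ∀ {a b} → a ℕ.≤ b → ι a ≤ ι b
  ι-mono-≤ {a} {b} a≤b = subst (λ k → ι a ≤ ι k) (ℕₚ.m+[n∸m]≡n a≤b)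
    (subst NonNeg (trans (solve 2 (λ A D → D := (A :+ D) :- A) refl (ι a) (ι (b ℕ.∸ a)))
                         (cong (_- ι a) (sym (ι-+ a _))))
           (ι-nonNeg (b ℕ.∸ a)))

  𝟙≤ι-suc : ∀ k → 𝟙 ≤ ι (suc k)
  𝟙≤ι-suc k = ι-mono-≤ (ℕ.s≤s ℕ.z≤n)

  x≤ι-suc*x : ∀ k {x} → NonNeg x → x ≤ ι (suc k) * x
  x≤ι-suc*x k {x} nx = subst (_≤ ι (suc k) * x) (*-identityˡ x) (*-monoʳ-≤ nx (𝟙≤ι-suc k))

  𝟙≤⇒pos : ∀ {x} → 𝟙 ≤ x → Positive x
  𝟙≤⇒pos {x} 𝟙≤x = subst Positive (solve 1 (λ x → (x :- con (+ 1)) :+ con (+ 1) := x) refl x) (nonNeg+pos 𝟙≤x 𝟙-pos)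

  <-asym : ∀ {a b} → a < b → b < a → ⊥
  <-asym a<b b<a = ≤⇒≯ (<⇒≤ b<a) a<b

  ≤-isPreorder : IsPreorder _≡_ _≤_
  ≤-isPreorder = record { isEquivalence = isEquivalence ; reflexive = ≤-reflexive ; trans = ≤-trans }

  <-resp-≡ : (∀ {x y z} → y ≡ z → x < y → x < z) × (∀ {x y z} → y ≡ z → y < x → z < x)
  <-resp-≡ = (λ { refl h → h }) , (λ { refl h → h })

  module ≤-Reasoning = Triple ≤-isPreorder <-asym <-trans <-resp-≡ <⇒≤ <-≤-trans ≤-<-trans

  *-cancelˡ-≡ : ∀ {x a b} → x ≢ 𝟘 → x * a ≡ x * b → a ≡ b
  *-cancelˡ-≡ {x} {a} {b} x≢𝟘 e with *-integral x (a - b) (begin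
    x * (a - b)     ≡⟨ solve 3 (λ x a b → x :* (a :- b) := x :* a :- x :* b) refl x a b ⟩
    x * a - x * b   ≡⟨ cong (_- x * b) e ⟩
    x * b - x * b   ≡⟨ solve 1 (λ y → y :- y := con (+ 0)) refl (x * b) ⟩
    𝟘               ∎)
    where open ≡-Reasoning
  ... | inj₁ x≡𝟘   = ⊥-elim (x≢𝟘 x≡𝟘)
  ... | inj₂ a-b≡𝟘 = x-y≡𝟘⇒x≡y a-b≡𝟘

  nonNeg*y-pos⇒pos : ∀ {x y} → NonNeg x → Positive (x * y) → Positive y
  nonNeg*y-pos⇒pos {x} {y} nx pxy with *ˢ≡positive (sign n x) (sign n y) (trans (sym (sign-mul x y)) pxy)
  ... | inj₁ (_ , py) = py
  ... | inj₂ (nx′ , _) = ⊥-elim (nx nx′)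

  𝟙≤* : ∀ {x y} → 𝟙 ≤ x → 𝟙 ≤ y → 𝟙 ≤ x * y
  𝟙≤* {x} {y} 𝟙≤x 𝟙≤y = subst NonNeg (solve 2 (λ x y → (x :- con (+ 1)) :* y :+ (y :- con (+ 1)) := x :* y :- con (+ 1)) refl x y)
                               (nonNeg+nonNeg (nonNeg*nonNeg 𝟙≤x (pos⇒nonNeg (𝟙≤⇒pos 𝟙≤y))) 𝟙≤y)

  x*y≤x : ∀ {x y} → NonNeg x → y ≤ 𝟙 → x * y ≤ x
  x*y≤x {x} nx y≤𝟙 = subst (x * _ ≤_) (solve 1 (λ x → x :* con (+ 1) := x) refl x) (*-monoˡ-≤ nx y≤𝟙)

  x≤x*y : ∀ {x y} → NonNeg x → 𝟙 ≤ y → x ≤ x * y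
  x≤x*y {x} nx 𝟙≤y = subst (_≤ x * _) (solve 1 (λ x → x :* con (+ 1) := x) refl x) (*-monoˡ-≤ nx 𝟙≤y)

  module ProductOne {α β : ZX n} (nα : NonNeg α) (nβ : NonNeg β) (αβ≡𝟙 : α * β ≡ 𝟙) where

    β<α⇒β<𝟙<α : β < α → β < 𝟙 × 𝟙 < α
    β<α⇒β<𝟙<α β<α = β<𝟙 , 𝟙<α
      where
      𝟙<α : 𝟙 < α
      𝟙<α with <⊎≥ 𝟙 α
      ... | inj₁ 𝟙<α = 𝟙<α
      ... | inj₂ α≤𝟙 = ⊥-elim (≤⇒≯ ≤-refl (subst (_< 𝟙) (trans (*-comm β α) αβ≡𝟙)
                                            (≤-<-trans (x*y≤x nβ α≤𝟙) (<-≤-trans β<α α≤𝟙))))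
      β<𝟙 : β < 𝟙
      β<𝟙 with <⊎≥ β 𝟙
      ... | inj₁ β<𝟙 = β<𝟙
      ... | inj₂ 𝟙≤β = ⊥-elim (≤⇒≯ (subst (α ≤_) αβ≡𝟙 (x≤x*y nα 𝟙≤β)) 𝟙<α)

    α≤β⇒α≤𝟙≤β : α ≤ β → α ≤ 𝟙 × 𝟙 ≤ β
    α≤β⇒α≤𝟙≤β α≤β = α≤𝟙 , 𝟙≤β
      where
      α≤𝟙 : α ≤ 𝟙
      α≤𝟙 with <⊎≥ 𝟙 α
      ... | inj₁ 𝟙<α = ⊥-elim (≤⇒≯ (subst (α ≤_) αβ≡𝟙 (x≤x*y nα (<⇒≤ (<-≤-trans 𝟙<α α≤β)))) 𝟙<α)
      ... | inj₂ α≤𝟙 = α≤𝟙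
      𝟙≤β : 𝟙 ≤ β
      𝟙≤β with <⊎≥ β 𝟙
      ... | inj₁ β<𝟙 = ⊥-elim (≤⇒≯ ≤-refl (subst (_< 𝟙) (trans (*-comm β α) αβ≡𝟙)
                                            (≤-<-trans (x*y≤x nβ α≤𝟙) β<𝟙)))
      ... | inj₂ 𝟙≤β = 𝟙≤β

combine-zer : ∀ s d → combine s zer d ≡ s
combine-zer zer      _ = refl
combine-zer positive _ = refl
combine-zer negative _ = refl

combine≡dominant : ∀ sa sb sN → (sa ≡ zer → sN ≢ positive) → (sb ≡ zer → sN ≢ negative) →
                   (sN ≡ zer → sa ≡ zer × sb ≡ zer) → combine sa sb sN ≡ dominant sN sa sb
combine≡dominant zer      sb       positive fa _  _  = ⊥-elim (fa refl refl)
combine≡dominant zer      sb       zer      _  _  fN = proj₂ (fN refl)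
combine≡dominant zer      sb       negative _  _  _  = refl
combine≡dominant positive sb       zer      _  _  fN with proj₁ (fN refl)
... | ()
combine≡dominant negative sb       zer      _  _  fN with proj₁ (fN refl)
... | ()
combine≡dominant positive zer      positive _  _  _  = refl
combine≡dominant positive zer      negative _  fb _  = ⊥-elim (fb refl refl)
combine≡dominant positive positive positive _  _  _  = refl
combine≡dominant positive positive negative _  _  _  = refl
combine≡dominant positive negative positive _  _  _  = refl
combine≡dominant positive negative negative _  _  _  = refl
combine≡dominant negative zer      positive _  _  _  = refl
combine≡dominant negative zer      negative _  fb _  = ⊥-elim (fb refl refl)
combine≡dominant negative positive positive _  _  _  = refl
combine≡dominant negative positive negative _  _  _  = refl
combine≡dominant negative negative positive _  _  _  = refl
combine≡dominant negative negative negative _  _  _  = refl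

module Adjoin {n : ℕ} (O : SignLaws n) (genSq-pos : Pos n (genSq n))
              (genSq-nonSquare : ∀ a b → mul n a a ≡ mul n (mul n b b) (genSq n) → b ≡ 0# n) where
  open OrderedRing O

  g : ZX n
  g = genSq n

  -- relNorm, with its factors ordered as in the definition of sign (suc n)
  norm : ZX n → ZX n → ZX n
  norm a b = a * a - b * b * g

  norm-* : ∀ a b c e → norm (a * c + b * e * g) (a * e + b * c) ≡ norm a b * norm c e
  norm-* a b c e = solve 5 (λ a b c e g →
      (a :* c :+ b :* e :* g) :* (a :* c :+ b :* e :* g) :- (a :* e :+ b :* c) :* (a :* e :+ b :* c) :* g
      := (a :* a :- b :* b :* g) :* (c :* c :- e :* e :* g)) refl a b c e g

  norm-neg : ∀ a b → norm (- a) (- b) ≡ norm a b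
  norm-neg a b = solve 3 (λ a b g → (:- a) :* (:- a) :- (:- b) :* (:- b) :* g := a :* a :- b :* b :* g) refl a b g

  norm-shift : ∀ s t r → norm (s + r) t ≡ norm s t + r * (s + (s + r))
  norm-shift s t r = solve 4 (λ s t r g → (s :+ r) :* (s :+ r) :- t :* t :* g
                                       := (s :* s :- t :* t :* g) :+ r :* (s :+ (s :+ r))) refl s t r g

  sign-*g : ∀ y → sign n (y * g) ≡ sign n y
  sign-*g y = trans (cong (sign n) (*-comm y g)) (sign-pos* y genSq-pos)

  nonNeg-b²g : ∀ b → NonNeg (b * b * g)
  nonNeg-b²g b = subst (λ s → s ≢ negative) (sym (sign-*g (b * b))) (square-nonNeg b)

  norm≡𝟘⇒≡𝟘 : ∀ a b → norm a b ≡ 𝟘 → a ≡ 𝟘 × b ≡ 𝟘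
  norm≡𝟘⇒≡𝟘 a b e = a≡𝟘 , b≡𝟘
    where
    a²≡b²g : a * a ≡ b * b * g
    a²≡b²g = x-y≡𝟘⇒x≡y e
    b≡𝟘 = genSq-nonSquare a b a²≡b²g
    a≡𝟘 : a ≡ 𝟘
    a≡𝟘 = sign-zer⇒≡0 a (*ˢ-self≡zer (sign n a) (trans (sym (sign-mul a a)) (≡𝟘⇒sign-zer (begin
      a * a       ≡⟨ a²≡b²g ⟩
      b * b * g   ≡⟨ cong (λ z → z * z * g) b≡𝟘 ⟩
      𝟘 * 𝟘 * g   ≡⟨ solve 1 (λ g → con (+ 0) :* con (+ 0) :* g := con (+ 0)) refl g ⟩
      𝟘           ∎))))
      where open ≡-Reasoning

  norm-𝟘ˡ≯𝟘 : ∀ b → Positive (norm 𝟘 b) → ⊥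
  norm-𝟘ˡ≯𝟘 b p = nonNeg-b²g b (-pos⇒neg (subst Positive
    (solve 2 (λ b g → con (+ 0) :* con (+ 0) :- b :* b :* g := :- (b :* b :* g)) refl b g) p))

  norm-𝟘ʳ≮𝟘 : ∀ a → Negative (norm a 𝟘) → ⊥
  norm-𝟘ʳ≮𝟘 a n = square-nonNeg a (subst Negative
    (solve 2 (λ a g → a :* a :- con (+ 0) :* con (+ 0) :* g := a :* a) refl a g) n)

  sign-pair : ∀ a b → sign (suc n) (a , b) ≡ dominant (sign n (norm a b)) (sign n a) (sign n b)
  sign-pair a b = combine≡dominant (sign n a) (sign n b) (sign n (norm a b)) a≡𝟘⇒norm≯𝟘 b≡𝟘⇒norm≮𝟘 norm≡𝟘
    where
    a≡𝟘⇒norm≯𝟘 : sign n a ≡ zer → sign n (norm a b) ≢ positive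
    a≡𝟘⇒norm≯𝟘 sa = norm-𝟘ˡ≯𝟘 b ∘ subst (λ z → Positive (norm z b)) (sign-zer⇒≡0 a sa)
    b≡𝟘⇒norm≮𝟘 : sign n b ≡ zer → sign n (norm a b) ≢ negative
    b≡𝟘⇒norm≮𝟘 sb = norm-𝟘ʳ≮𝟘 a ∘ subst (λ z → Negative (norm a z)) (sign-zer⇒≡0 b sb)
    norm≡𝟘 : sign n (norm a b) ≡ zer → sign n a ≡ zer × sign n b ≡ zer
    norm≡𝟘 e with norm≡𝟘⇒≡𝟘 a b (sign-zer⇒≡0 _ e)
    ... | a≡𝟘 , b≡𝟘 = ≡𝟘⇒sign-zer a≡𝟘 , ≡𝟘⇒sign-zer b≡𝟘

  sign-emb : ∀ w → sign (suc n) (w , 𝟘) ≡ sign n w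
  sign-emb w = trans (cong (λ t → combine (sign n w) t (sign n (norm w 𝟘))) sign-𝟘) (combine-zer _ _)

  pos-pair-cases : ∀ {a b} → Pos (suc n) (a , b) →
                   (Positive (norm a b) × Positive a) ⊎ (Negative (norm a b) × Positive b)
  pos-pair-cases {a} {b} p with sign n (norm a b) in eN | trans (sym (sign-pair a b)) p
  ... | positive | pa = inj₁ (refl , pa)
  ... | negative | pb = inj₂ (refl , pb)

  pos-pairˡ : ∀ {a b} → Positive (norm a b) → Positive a → Pos (suc n) (a , b)
  pos-pairˡ {a} {b} pN pa = trans (sign-pair a b) (trans (cong (λ s → dominant s _ _) pN) pa)

  pos-pairʳ : ∀ {a b} → Negative (norm a b) → Positive b → Pos (suc n) (a , b)
  pos-pairʳ {a} {b} nN pb = trans (sign-pair a b) (trans (cong (λ s → dominant s _ _) nN) pb)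

  sign-zer⇒≡0′ : ∀ x → sign (suc n) x ≡ zer → x ≡ 0# (suc n)
  sign-zer⇒≡0′ (a , b) sx with sign n (norm a b) in eN | trans (sym (sign-pair a b)) sx
  ... | zer      | _  = let a≡𝟘 , b≡𝟘 = norm≡𝟘⇒≡𝟘 a b (sign-zer⇒≡0 _ eN) in cong₂ _,_ a≡𝟘 b≡𝟘
  ... | positive | sa = ⊥-elim (norm-𝟘ˡ≯𝟘 b (subst (λ z → Positive (norm z b)) (sign-zer⇒≡0 a sa) eN))
  ... | negative | sb = ⊥-elim (norm-𝟘ʳ≮𝟘 a (subst (λ z → Negative (norm a z)) (sign-zer⇒≡0 b sb) eN))

  sign-neg′ : ∀ x → sign (suc n) (neg (suc n) x) ≡ flip (sign (suc n) x)
  sign-neg′ (a , b) = begin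
    sign (suc n) (- a , - b)                                               ≡⟨ sign-pair (- a) (- b) ⟩
    dominant (sign n (norm (- a) (- b))) (sign n (- a)) (sign n (- b))
      ≡⟨ cong₂ (λ s t → dominant s (sign n (- a)) t) (cong (sign n) (norm-neg a b)) (sign-neg b) ⟩
    dominant (sign n (norm a b)) (sign n (- a)) (flip (sign n b))
      ≡⟨ cong (λ s → dominant (sign n (norm a b)) s (flip (sign n b))) (sign-neg a) ⟩
    dominant (sign n (norm a b)) (flip (sign n a)) (flip (sign n b))       ≡⟨ dominant-flip (sign n (norm a b)) (sign n a) (sign n b) ⟩
    flip (dominant (sign n (norm a b)) (sign n a) (sign n b))              ≡⟨ cong flip (sym (sign-pair a b)) ⟩
    flip (sign (suc n) (a , b))                                            ∎
    where open ≡-Reasoning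

  norm<𝟘⇒< : ∀ {a b} → Negative (norm a b) → a * a < b * b * g
  norm<𝟘⇒< {a} {b} e =
    subst Positive (solve 3 (λ a b g → :- (a :* a :- b :* b :* g) := b :* b :* g :- a :* a) refl a b g) (neg⇒-pos e)

  dominant-* : ∀ a b c e sx sy → sign n (norm a b) ≡ sx → sign n (norm c e) ≡ sy →
               dominant (sx *ˢ sy) (sign n (a * c + b * e * g)) (sign n (a * e + b * c))
               ≡ dominant sx (sign n a) (sign n b) *ˢ dominant sy (sign n c) (sign n e)
  dominant-* a b c e zer      sy       _  _  = refl
  dominant-* a b c e positive zer      _  _  = sym (*ˢ-zeroʳ (sign n a))
  dominant-* a b c e negative zer      _  _  = sym (*ˢ-zeroʳ (sign n b))
  dominant-* a b c e positive positive ex ey = trans (sign-+-dominant (a * c) (b * e * g) h) (sign-mul a c)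
    where
    h : Positive (a * c * (a * c) - b * e * g * (b * e * g))
    h = subst Positive (solve 5 (λ a b c e g → a :* a :* (c :* c) :- b :* b :* g :* (e :* e :* g)
                                            := a :* c :* (a :* c) :- b :* e :* g :* (b :* e :* g)) refl a b c e g)
              (*-mono-< ex (nonNeg-b²g b) ey (nonNeg-b²g e))
  dominant-* a b c e positive negative ex ey = trans (sign-+-dominant (a * e) (b * c) h) (sign-mul a e)
    where
    h : Positive (a * e * (a * e) - b * c * (b * c))
    h = *-cancelˡ-< genSq-pos (subst Positive
          (solve 5 (λ a b c e g → a :* a :* (e :* e :* g) :- b :* b :* g :* (c :* c)
                               := g :* (a :* e :* (a :* e)) :- g :* (b :* c :* (b :* c))) refl a b c e g)
          (*-mono-< ex (nonNeg-b²g b) (norm<𝟘⇒< ey) (square-nonNeg c)))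
  dominant-* a b c e negative positive ex ey =
    trans (cong (sign n) (+-comm _ _)) (trans (sign-+-dominant (b * c) (a * e) h) (sign-mul b c))
    where
    h : Positive (b * c * (b * c) - a * e * (a * e))
    h = *-cancelˡ-< genSq-pos (subst Positive
          (solve 5 (λ a b c e g → b :* b :* g :* (c :* c) :- a :* a :* (e :* e :* g)
                               := g :* (b :* c :* (b :* c)) :- g :* (a :* e :* (a :* e))) refl a b c e g)
          (*-mono-< (norm<𝟘⇒< ex) (square-nonNeg a) ey (nonNeg-b²g e)))
  dominant-* a b c e negative negative ex ey =
    trans (cong (sign n) (+-comm _ _))
          (trans (sign-+-dominant (b * e * g) (a * c) h) (trans (sign-*g (b * e)) (sign-mul b e)))
    where
    h : Positive (b * e * g * (b * e * g) - a * c * (a * c))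
    h = subst Positive (solve 5 (λ a b c e g → b :* b :* g :* (e :* e :* g) :- a :* a :* (c :* c)
                                            := b :* e :* g :* (b :* e :* g) :- a :* c :* (a :* c)) refl a b c e g)
              (*-mono-< (norm<𝟘⇒< ex) (square-nonNeg a) (norm<𝟘⇒< ey) (square-nonNeg c))

  sign-mul′ : ∀ x y → sign (suc n) (mul (suc n) x y) ≡ sign (suc n) x *ˢ sign (suc n) y
  sign-mul′ (a , b) (c , e) = begin
    sign (suc n) (u , v)                                                 ≡⟨ sign-pair u v ⟩
    dominant (sign n (norm u v)) (sign n u) (sign n v)
      ≡⟨ cong (λ s → dominant s (sign n u) (sign n v)) (trans (cong (sign n) (norm-* a b c e)) (sign-mul _ _)) ⟩
    dominant (sign n (norm a b) *ˢ sign n (norm c e)) (sign n u) (sign n v) ≡⟨ dominant-* a b c e _ _ refl refl ⟩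
    dominant (sign n (norm a b)) (sign n a) (sign n b) *ˢ dominant (sign n (norm c e)) (sign n c) (sign n e)
      ≡⟨ sym (cong₂ _*ˢ_ (sign-pair a b) (sign-pair c e)) ⟩
    sign (suc n) (a , b) *ˢ sign (suc n) (c , e)                         ∎
    where
    open ≡-Reasoning
    u v : ZX n
    u = a * c + b * e * g
    v = a * e + b * c

  shift-pos : ∀ w r → Positive r → Pos (suc n) w → Pos (suc n) (add (suc n) w (r , 𝟘))
  shift-pos (s , t) r pr pw = subst (λ z → Pos (suc n) (s + r , z)) (sym (+-identityʳ t)) (shift pw)
    where
    shift : Pos (suc n) (s , t) → Pos (suc n) (s + r , t)
    shift pst with pos-pair-cases pst
    ... | inj₁ (pN , ps) = pos-pairˡ (subst Positive (sym (norm-shift s t r))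
                                            (pos-add _ _ pN (pos*pos pr (pos-add _ _ ps ps+r)))) ps+r
      where ps+r = pos-add _ _ ps pr
    ... | inj₂ (nN , pt) with pos⊎≡𝟘⊎neg (norm (s + r) t)
    ...   | inj₂ (inj₂ nN′) = pos-pairʳ nN′ pt
    ...   | inj₂ (inj₁ N≡𝟘) = ⊥-elim (pos⇒≢𝟘 pt (proj₂ (norm≡𝟘⇒≡𝟘 (s + r) t N≡𝟘)))
    ...   | inj₁ eN′ with pos⊎-nonNeg (s + r)
    ...     | inj₁ ps+r  = pos-pairˡ eN′ ps+r
    ...     | inj₂ s+r≤𝟘 = ⊥-elim (pos⇒¬neg (subst Positive norm-unshift
                              (pos-add _ _ eN′ (pos*pos pr (pos+nonNeg (pos+nonNeg pr s+r≤𝟘) s+r≤𝟘)))) nN)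
      where
      norm-unshift : norm (s + r) t + r * ((r + - (s + r)) + - (s + r)) ≡ norm s t
      norm-unshift = solve 4 (λ s t r g → ((s :+ r) :* (s :+ r) :- t :* t :* g) :+ r :* ((r :+ :- (s :+ r)) :+ :- (s :+ r))
                                       := s :* s :- t :* t :* g) refl s t r g

  shift-neg : ∀ w r → Negative r → sign (suc n) w ≡ negative → sign (suc n) (add (suc n) w (r , 𝟘)) ≡ negative
  shift-neg (s , t) r nr nw = trans (sym (flip-involutive _)) (cong flip (trans (sym (sign-neg′ (s + r , t + 𝟘)))
    (subst (Pos (suc n)) (cong₂ _,_ (solve 2 (λ s r → :- s :+ :- r := :- (s :+ r)) refl s r)
                                    (solve 1 (λ t → :- t :+ con (+ 0) := :- (t :+ con (+ 0))) refl t))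
           (shift-pos (- s , - t) (- r) (neg⇒-pos nr) (trans (sign-neg′ (s , t)) (cong flip nw))))))

  infixl 6 _⊕_
  infixl 7 _⊛_

  _⊕_ _⊛_ : ZX (suc n) → ZX (suc n) → ZX (suc n)
  _⊕_ = add (suc n)
  _⊛_ = mul (suc n)

  norm-conj : ∀ a b → norm a (- b) ≡ norm a b
  norm-conj a b = solve 3 (λ a b g → a :* a :- (:- b) :* (:- b) :* g := a :* a :- b :* b :* g) refl a b g

  x*x̄≡norm : ∀ a b → (a , b) ⊛ (a , - b) ≡ (norm a b , 𝟘)
  x*x̄≡norm a b = cong₂ _,_ (solve 3 (λ a b g → a :* a :+ b :* (:- b) :* g := a :* a :- b :* b :* g) refl a b g)
                           (solve 2 (λ a b → a :* (:- b) :+ b :* a := con (+ 0)) refl a b)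

  conj-expand : ∀ a b y → ((a , b) ⊕ y) ⊛ (a , - b) ≡ y ⊛ (a , - b) ⊕ (norm a b , 𝟘)
  conj-expand a b y = begin
    ((a , b) ⊕ y) ⊛ (a , - b)               ≡⟨ L.distribʳ (a , - b) (a , b) y ⟩
    (a , b) ⊛ (a , - b) ⊕ y ⊛ (a , - b)     ≡⟨ cong (_⊕ y ⊛ (a , - b)) (x*x̄≡norm a b) ⟩
    (norm a b , 𝟘) ⊕ y ⊛ (a , - b)          ≡⟨ L.+-comm _ _ ⟩
    y ⊛ (a , - b) ⊕ (norm a b , 𝟘)          ∎
    where
    open ≡-Reasoning
    module L = RingLaws (ringLaws (suc n))

  -- x x̄ = N(x) lies in the base ring, so (x + y) x̄ = y x̄ + N(x) and the sign of x + y is read off by shifting.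
  pos-add′ : ∀ x y → Pos (suc n) x → Pos (suc n) y → Pos (suc n) (x ⊕ y)
  pos-add′ (a , b) y px py with pos-pair-cases px
  ... | inj₁ (pN , pa) = begin
    sign (suc n) (x ⊕ y)                     ≡⟨ sym (*ˢ-identityʳ _) ⟩
    sign (suc n) (x ⊕ y) *ˢ positive         ≡⟨ cong (sign (suc n) (x ⊕ y) *ˢ_) (sym sign-x̄) ⟩
    sign (suc n) (x ⊕ y) *ˢ sign (suc n) x̄   ≡⟨ sym (sign-mul′ (x ⊕ y) x̄) ⟩
    sign (suc n) ((x ⊕ y) ⊛ x̄)               ≡⟨ cong (sign (suc n)) (conj-expand a b y) ⟩
    sign (suc n) (y ⊛ x̄ ⊕ (norm a b , 𝟘))    ≡⟨ shift-pos (y ⊛ x̄) _ pN (trans (sign-mul′ y x̄) (cong₂ _*ˢ_ py sign-x̄)) ⟩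
    positive                                 ∎
    where
    open ≡-Reasoning
    x x̄ : ZX (suc n)
    x = a , b
    x̄ = a , - b
    sign-x̄ : sign (suc n) x̄ ≡ positive
    sign-x̄ = pos-pairˡ (subst Positive (sym (norm-conj a b)) pN) pa
  ... | inj₂ (nN , pb) = *ˢ-negative≡negative _ (begin
    sign (suc n) (x ⊕ y) *ˢ negative         ≡⟨ cong (sign (suc n) (x ⊕ y) *ˢ_) (sym sign-x̄) ⟩
    sign (suc n) (x ⊕ y) *ˢ sign (suc n) x̄   ≡⟨ sym (sign-mul′ (x ⊕ y) x̄) ⟩
    sign (suc n) ((x ⊕ y) ⊛ x̄)               ≡⟨ cong (sign (suc n)) (conj-expand a b y) ⟩
    sign (suc n) (y ⊛ x̄ ⊕ (norm a b , 𝟘))    ≡⟨ shift-neg (y ⊛ x̄) _ nN (trans (sign-mul′ y x̄) (cong₂ _*ˢ_ py sign-x̄)) ⟩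
    negative                                 ∎)
    where
    open ≡-Reasoning
    x x̄ : ZX (suc n)
    x = a , b
    x̄ = a , - b
    sign-x̄ : sign (suc n) x̄ ≡ negative
    sign-x̄ = trans (sign-pair a (- b)) (trans (cong₂ (λ s t → dominant s (sign n a) t)
                                                     (trans (cong (sign n) (norm-conj a b)) nN) (sign-neg b))
                                              (cong flip pb))

  signLaws-suc : SignLaws (suc n)
  signLaws-suc = record
    { sign-fromℤ  = λ a → trans (sign-emb (fromℤ n a)) (sign-fromℤ a)
    ; sign-zer⇒≡0 = sign-zer⇒≡0′
    ; sign-neg    = sign-neg′
    ; sign-mul    = sign-mul′
    ; pos-add     = pos-add′ }

even⊎odd : ∀ a → ∃[ c ] (a ≡ 2 ℕ.* c ⊎ a ≡ suc (2 ℕ.* c))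
even⊎odd zero = 0 , inj₁ refl
even⊎odd (suc a) with even⊎odd a
... | c , inj₁ refl = c , inj₂ refl
... | c , inj₂ refl = suc c , inj₁ (cong suc (sym (ℕₚ.+-suc c (c ℕ.+ 0))))

√2-irrational : ∀ a b → a ℕ.* a ≡ 2 ℕ.* (b ℕ.* b) → b ≡ 0
√2-irrational = <-rec _ descent
  where
  open Data.Nat.Solver.+-*-Solver
  descent : ∀ a → (∀ {a′} → a′ ℕ.< a → ∀ b → a′ ℕ.* a′ ≡ 2 ℕ.* (b ℕ.* b) → b ≡ 0) →
            ∀ b → a ℕ.* a ≡ 2 ℕ.* (b ℕ.* b) → b ≡ 0
  descent a rec zero    _ = refl
  descent a rec (suc k) e with even⊎odd a
  ... | c , inj₂ refl = ⊥-elim (ℕₚ.even≢odd (b ℕ.* b) (2 ℕ.* (c ℕ.* c) ℕ.+ 2 ℕ.* c) (trans (sym e)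
          (solve 1 (λ c → (con 1 :+ con 2 :* c) :* (con 1 :+ con 2 :* c)
                          := con 1 :+ con 2 :* (con 2 :* (c :* c) :+ con 2 :* c)) refl c)))
    where b = suc k
  ... | c , inj₁ refl = ⊥-elim (ℕₚ.0≢1+n (subst (λ c → (2 ℕ.* c) ℕ.* (2 ℕ.* c) ≡ 2 ℕ.* (b ℕ.* b)) c≡0 e))
    where
    b = suc k
    b²≡2c² : b ℕ.* b ≡ 2 ℕ.* (c ℕ.* c)
    b²≡2c² = sym (ℕₚ.*-cancelˡ-≡ _ _ 2 (trans (solve 1 (λ c → con 2 :* (con 2 :* (c :* c)) := (con 2 :* c) :* (con 2 :* c)) refl c) e))
    b<2c : b ℕ.< 2 ℕ.* c
    b<2c = ℕₚ.≰⇒> λ 2c≤b → ℕₚ.<⇒≱ (subst (b ℕ.* b ℕ.<_) (sym e) (ℕₚ.m<m+n (b ℕ.* b) (ℕ.s≤s ℕ.z≤n)))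
                                   (ℕₚ.*-mono-≤ 2c≤b 2c≤b)
    c≡0 : c ≡ 0
    c≡0 = rec b<2c c b²≡2c²

√2-irrationalℤ : ∀ u v → u ℤ.* u ≡ v ℤ.* v ℤ.* + 2 → v ≡ + 0
√2-irrationalℤ u v e = ℤₚ.∣i∣≡0⇒i≡0 (√2-irrational ℤ.∣ u ∣ ℤ.∣ v ∣ (begin
  ℤ.∣ u ∣ ℕ.* ℤ.∣ u ∣          ≡⟨ sym (ℤₚ.abs-* u u) ⟩
  ℤ.∣ u ℤ.* u ∣                 ≡⟨ cong ℤ.∣_∣ e ⟩
  ℤ.∣ v ℤ.* v ℤ.* + 2 ∣         ≡⟨ ℤₚ.abs-* (v ℤ.* v) (+ 2) ⟩
  ℤ.∣ v ℤ.* v ∣ ℕ.* 2           ≡⟨ cong (ℕ._* 2) (ℤₚ.abs-* v v) ⟩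
  ℤ.∣ v ∣ ℕ.* ℤ.∣ v ∣ ℕ.* 2     ≡⟨ ℕₚ.*-comm (ℤ.∣ v ∣ ℕ.* ℤ.∣ v ∣) 2 ⟩
  2 ℕ.* (ℤ.∣ v ∣ ℕ.* ℤ.∣ v ∣)   ∎))
  where open ≡-Reasoning

record Invariant (n : ℕ) : Set where
  field
    signLaws        : SignLaws n
    gen-nonNeg      : sign n (gen n) ≢ negative
    gen<2           : Lt n (gen n) (fromℤ n (+ 2))
    absNorm         : ZX n → ℤ
    absNorm-*       : ∀ x y → absNorm (mul n x y) ≡ absNorm x ℤ.* absNorm y
    absNorm≡0⇒≡0    : ∀ x → absNorm x ≡ + 0 → x ≡ 0# n
    -- N(2 ± X_{n+1}) = N(2 - X_n): both values are needed to carry the induction.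
    absNorm-2+X     : absNorm (add n (fromℤ n (+ 2)) (gen n)) ≡ + 2
    absNorm-2-X     : absNorm (sub n (fromℤ n (+ 2)) (gen n)) ≡ + 2
    divides-integer : ∀ x → x ≢ 0# n → ∃[ y ] ∃[ c ] (c ≢ + 0 × mul n x y ≡ fromℤ n c)
    integer-bound   : ∀ x → ∃[ B ] (Lt n x (fromℤ n (+ B)) × Lt n (neg n x) (fromℤ n (+ B)))

invariant-ℤ : Invariant zero
invariant-ℤ = record
  { signLaws = signLaws-ℤ ; gen-nonNeg = λ () ; gen<2 = refl
  ; absNorm = λ x → x ; absNorm-* = λ _ _ → refl ; absNorm≡0⇒≡0 = λ _ e → e
  ; absNorm-2+X = refl ; absNorm-2-X = refl
  ; divides-integer = λ x x≢0 → + 1 , x , x≢0 , ℤₚ.*-identityʳ x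
  ; integer-bound = bound }
  where
  open OrderedRing signLaws-ℤ
  x<x+1 : ∀ x → x < x + 𝟙
  x<x+1 x = subst Positive (solve 1 (λ x → con (+ 1) := x :+ con (+ 1) :- x) refl x) 𝟙-pos
  -x<x+1 : ∀ x → NonNeg x → - x < x + 𝟙
  -x<x+1 x nx = subst Positive (solve 1 (λ x → (x :+ x) :+ con (+ 1) := x :+ con (+ 1) :- (:- x)) refl x)
                      (nonNeg+pos (nonNeg+nonNeg nx nx) 𝟙-pos)
  bound : ∀ x → ∃[ B ] (x < ι B × - x < ι B)
  bound (+ k)    = k ℕ.+ 1 , x<x+1 (+ k) , -x<x+1 (+ k) (ι-nonNeg k)
  bound -[1+ k ] = suc k ℕ.+ 1 , -x<x+1 (+ suc k) (ι-nonNeg (suc k)) , x<x+1 (+ suc k)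

module InvariantStep {n : ℕ} (I : Invariant n) where
  open Invariant I
  open OrderedRing signLaws

  genSq-pos : Positive (genSq n)
  genSq-pos = pos+nonNeg (sign-fromℤ (+ 2)) gen-nonNeg

  genSq-nonSquare : ∀ a b → a * a ≡ b * b * genSq n → b ≡ 𝟘
  genSq-nonSquare a b e = absNorm≡0⇒≡0 b (√2-irrationalℤ (absNorm a) (absNorm b) (begin
    absNorm a ℤ.* absNorm a                  ≡⟨ sym (absNorm-* a a) ⟩
    absNorm (a * a)                          ≡⟨ cong absNorm e ⟩
    absNorm (b * b * genSq n)                ≡⟨ absNorm-* (b * b) (genSq n) ⟩
    absNorm (b * b) ℤ.* absNorm (genSq n)    ≡⟨ cong₂ ℤ._*_ (absNorm-* b b) absNorm-2+X ⟩
    absNorm b ℤ.* absNorm b ℤ.* + 2          ∎))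
    where open ≡-Reasoning

  open Adjoin signLaws genSq-pos genSq-nonSquare public
  module L = OrderedRing signLaws-suc

  X : ZX (suc n)
  X = gen (suc n)

  X-pos : Pos (suc n) X
  X-pos = cong₂ (λ s t → combine s t (sign n (norm 𝟘 𝟙))) sign-𝟘 𝟙-pos

  𝟙<X : Lt (suc n) (1# (suc n)) X
  𝟙<X = pos-pairʳ (subst Negative (sym norm-X-1) (pos⇒-neg (pos+nonNeg 𝟙-pos gen-nonNeg)))
                  (subst Positive (solve 0 (con (+ 1) := con (+ 1) :- con (+ 0)) refl) 𝟙-pos)
    where
    norm-X-1 : norm (𝟘 - 𝟙) (𝟙 - 𝟘) ≡ - (𝟙 + gen n)
    norm-X-1 = solve 1 (λ x → (con (+ 0) :- con (+ 1)) :* (con (+ 0) :- con (+ 1))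
                              :- (con (+ 1) :- con (+ 0)) :* (con (+ 1) :- con (+ 0)) :* (con (+ 2) :+ x)
                              := :- (con (+ 1) :+ x)) refl (gen n)

  norm-2+X : norm (fromℤ n (+ 2) + 𝟘) (𝟘 + 𝟙) ≡ fromℤ n (+ 2) - gen n
  norm-2+X = solve 1 (λ x → (con (+ 2) :+ con (+ 0)) :* (con (+ 2) :+ con (+ 0))
                            :- (con (+ 0) :+ con (+ 1)) :* (con (+ 0) :+ con (+ 1)) :* (con (+ 2) :+ x)
                            := con (+ 2) :- x) refl (gen n)

  norm-2-X : norm (fromℤ n (+ 2) - 𝟘) (𝟘 - 𝟙) ≡ fromℤ n (+ 2) - gen n
  norm-2-X = solve 1 (λ x → (con (+ 2) :- con (+ 0)) :* (con (+ 2) :- con (+ 0))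
                            :- (con (+ 0) :- con (+ 1)) :* (con (+ 0) :- con (+ 1)) :* (con (+ 2) :+ x)
                            := con (+ 2) :- x) refl (gen n)

  X<2 : Lt (suc n) X (fromℤ (suc n) (+ 2))
  X<2 = pos-pairˡ (subst Positive (sym norm-2-X) gen<2)
                  (subst Positive (solve 0 (con (+ 2) := con (+ 2) :- con (+ 0)) refl) (sign-fromℤ (+ 2)))

  -- B - (a + b X) = (Ba - a) + (2 - X) Bb + X (Bb - b) for B = Ba + 2 Bb.
  pair<ι : ∀ {a b Ba Bb} → a < ι Ba → b < ι Bb → Lt (suc n) (a , b) (fromℤ (suc n) (+ (Ba ℕ.+ (Bb ℕ.+ Bb))))
  pair<ι {a} {b} {Ba} {Bb} a<Ba b<Bb = subst (Pos (suc n)) (cong₂ _,_ first second)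
    (L.pos-add _ _ (L.pos+nonNeg (trans (sign-emb _) a<Ba) (L.nonNeg*nonNeg (L.pos⇒nonNeg X<2) ιBb-nonNeg))
                   (L.pos*pos X-pos (trans (sign-emb _) b<Bb)))
    where
    ιBb-nonNeg : sign (suc n) (ι Bb , 𝟘) ≢ negative
    ιBb-nonNeg = subst (_≢ negative) (sym (sign-emb (ι Bb))) (ι-nonNeg Bb)
    first : ι Ba - a + ((fromℤ n (+ 2) + - 𝟘) * ι Bb + (𝟘 + - 𝟙) * 𝟘 * g) + (𝟘 * (ι Bb - b) + 𝟙 * 𝟘 * g)
          ≡ ι (Ba ℕ.+ (Bb ℕ.+ Bb)) + - a
    first = trans (solve 5 (λ a A B g b → A :- a :+ ((con (+ 2) :+ :- con (+ 0)) :* B :+ (con (+ 0) :+ :- con (+ 1)) :* con (+ 0) :* g)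
                                           :+ (con (+ 0) :* (B :- b) :+ con (+ 1) :* con (+ 0) :* g)
                                        := (A :+ (B :+ B)) :+ :- a) refl a (ι Ba) (ι Bb) g b)
                  (cong (_+ - a) (sym (trans (ι-+ Ba _) (cong (λ z → ι Ba + z) (ι-+ Bb Bb)))))
    second : 𝟘 + ((fromℤ n (+ 2) + - 𝟘) * 𝟘 + (𝟘 + - 𝟙) * ι Bb) + (𝟘 * 𝟘 + 𝟙 * (ι Bb - b)) ≡ 𝟘 + - b
    second = solve 2 (λ b B → con (+ 0) :+ ((con (+ 2) :+ :- con (+ 0)) :* con (+ 0) :+ (con (+ 0) :+ :- con (+ 1)) :* B)
                              :+ (con (+ 0) :* con (+ 0) :+ con (+ 1) :* (B :- b)) := con (+ 0) :+ :- b) refl b (ι Bb)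

  divides-integer′ : ∀ x → x ≢ 0# (suc n) → ∃[ y ] ∃[ c ] (c ≢ + 0 × x ⊛ y ≡ fromℤ (suc n) c)
  divides-integer′ (a , b) x≢0 with divides-integer (norm a b) (λ N≡𝟘 → x≢0 (let a≡𝟘 , b≡𝟘 = norm≡𝟘⇒≡𝟘 a b N≡𝟘
                                                                            in cong₂ _,_ a≡𝟘 b≡𝟘))
  ... | y , c , c≢0 , Ny≡c = (a , - b) ⊛ (y , 𝟘) , c , c≢0 , (begin
    (a , b) ⊛ ((a , - b) ⊛ (y , 𝟘))   ≡⟨ sym (L.*-assoc (a , b) (a , - b) (y , 𝟘)) ⟩
    ((a , b) ⊛ (a , - b)) ⊛ (y , 𝟘)   ≡⟨ cong (_⊛ (y , 𝟘)) (x*x̄≡norm a b) ⟩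
    (norm a b , 𝟘) ⊛ (y , 𝟘)          ≡⟨ cong₂ _,_ (trans (solve 3 (λ N y g → N :* y :+ con (+ 0) :* con (+ 0) :* g := N :* y) refl (norm a b) y g) Ny≡c)
                                                   (solve 2 (λ N y → N :* con (+ 0) :+ con (+ 0) :* y := con (+ 0)) refl (norm a b) y) ⟩
    fromℤ (suc n) c                   ∎)
    where open ≡-Reasoning

  invariant-suc : Invariant (suc n)
  invariant-suc = record
    { signLaws = signLaws-suc
    ; gen-nonNeg = L.pos⇒nonNeg X-pos
    ; gen<2 = X<2
    ; absNorm = λ { (a , b) → absNorm (norm a b) }
    ; absNorm-* = λ { (a , b) (c , e) → trans (cong absNorm (norm-* a b c e)) (absNorm-* _ _) }
    ; absNorm≡0⇒≡0 = λ { (a , b) N≡0 → let a≡𝟘 , b≡𝟘 = norm≡𝟘⇒≡𝟘 a b (absNorm≡0⇒≡0 _ N≡0) in cong₂ _,_ a≡𝟘 b≡𝟘 }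
    ; absNorm-2+X = trans (cong absNorm norm-2+X) absNorm-2-X
    ; absNorm-2-X = trans (cong absNorm norm-2-X) absNorm-2-X
    ; divides-integer = divides-integer′
    ; integer-bound = λ { (a , b) → bound (integer-bound a) (integer-bound b) }
    }
    where
    bound : ∀ {a b} → ∃[ B ] (a < ι B × - a < ι B) → ∃[ B ] (b < ι B × - b < ι B) →
            ∃[ B ] (Lt (suc n) (a , b) (fromℤ (suc n) (+ B)) × Lt (suc n) (- a , - b) (fromℤ (suc n) (+ B)))
    bound (Ba , a<Ba , -a<Ba) (Bb , b<Bb , -b<Bb) = Ba ℕ.+ (Bb ℕ.+ Bb) , pair<ι a<Ba b<Bb , pair<ι -a<Ba -b<Bb

invariant : ∀ n → Invariant n
invariant zero    = invariant-ℤ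
invariant (suc n) = InvariantStep.invariant-suc (invariant n)

induction-mod-3 : ∀ {ℓ} {P : ℕ → Set ℓ} → P 0 → P 1 → P 2 → (∀ k → P k → P (3 ℕ.+ k)) → ∀ k → P k
induction-mod-3 p₀ p₁ p₂ step zero                = p₀
induction-mod-3 p₀ p₁ p₂ step (suc zero)          = p₁
induction-mod-3 p₀ p₁ p₂ step (suc (suc zero))    = p₂
induction-mod-3 p₀ p₁ p₂ step (suc (suc (suc k))) = step k (induction-mod-3 p₀ p₁ p₂ step k)

⌊_/3⌋ : ℕ → ℕ
⌊ suc (suc (suc k)) /3⌋ = suc ⌊ k /3⌋
⌊ _ /3⌋                 = 0

m*3≤k⇒m≤⌊k/3⌋ : ∀ m k → m ℕ.* 3 ℕ.≤ k → m ℕ.≤ ⌊ k /3⌋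
m*3≤k⇒m≤⌊k/3⌋ zero    k                   _                             = ℕ.z≤n
m*3≤k⇒m≤⌊k/3⌋ (suc m) (suc (suc (suc k))) (ℕ.s≤s (ℕ.s≤s (ℕ.s≤s m*3≤k))) = ℕ.s≤s (m*3≤k⇒m≤⌊k/3⌋ m k m*3≤k)

m≤m+n+o : ∀ m n o → m ℕ.≤ m ℕ.+ n ℕ.+ o
m≤m+n+o m n o = ℕₚ.≤-trans (ℕₚ.m≤m+n m n) (ℕₚ.m≤m+n _ o)

n≤m+n+o : ∀ m n o → n ℕ.≤ m ℕ.+ n ℕ.+ o
n≤m+n+o m n o = ℕₚ.≤-trans (ℕₚ.m≤n+m n m) (ℕₚ.m≤m+n _ o)

o≤m+n+o : ∀ m n o → o ℕ.≤ m ℕ.+ n ℕ.+ o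
o≤m+n+o m n o = ℕₚ.m≤n+m o _

chain-3 : ∀ {a ℓ} {A : Set a} (R : A → A → Set ℓ) → (∀ {x y z} → R x y → R y z → R x z) → (∀ {x} → R x x) →
          (v : ℕ → A) → (∀ k → R (v k) (v (3 ℕ.+ k))) → ∀ K j → R (v K) (v (j ℕ.* 3 ℕ.+ K))
chain-3 R trans′ refl′ v step K zero    = refl′
chain-3 R trans′ refl′ v step K (suc j) = trans′ (chain-3 R trans′ refl′ v step K j) (step (j ℕ.* 3 ℕ.+ K))

module Archimedean {n : ℕ} (I : Invariant n) where
  open Invariant I
  open OrderedRing signLaws public

  ∣x∣<ι : ∀ x → ∃[ B ] ∣ x ∣ < ι B
  ∣x∣<ι x with integer-bound x
  ... | B , x<B , -x<B = B , ∣∣-< x<B -x<B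

  𝟙≤∣fromℤ∣ : ∀ c → c ≢ + 0 → 𝟙 ≤ ∣ fromℤ n c ∣
  𝟙≤∣fromℤ∣ (+ zero)  c≢0 = ⊥-elim (c≢0 refl)
  𝟙≤∣fromℤ∣ (+ suc k) _   = subst (𝟙 ≤_) (sym (∣x∣≡x (ι-nonNeg (suc k)))) (𝟙≤ι-suc k)
  𝟙≤∣fromℤ∣ -[1+ k ]  _   = subst (𝟙 ≤_) (sym (trans (cong ∣_∣ (fromℤ-neg (+ suc k)))
                                              (trans (∣-x∣≡∣x∣ (ι (suc k))) (∣x∣≡x (ι-nonNeg (suc k))))))
                                  (𝟙≤ι-suc k)

  archimedean : ∀ y → y ≢ 𝟘 → ∃[ N ] 𝟙 ≤ ι N * ∣ y ∣
  archimedean y y≢𝟘 with divides-integer y y≢𝟘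
  ... | z , c , c≢0 , yz≡c with ∣x∣<ι z
  ...   | B , ∣z∣<B = B , ≤-trans (𝟙≤∣fromℤ∣ c c≢0)
            (subst₂ _≤_ (trans (sym (∣x*y∣≡∣x∣*∣y∣ y z)) (cong ∣_∣ yz≡c)) (*-comm ∣ y ∣ (ι B))
                    (*-monoˡ-≤ (∣x∣-nonNeg y) (<⇒≤ ∣z∣<B)))

  unbounded-multiples : ∀ y z → y ≢ 𝟘 → (∀ J → ι (suc J) * ∣ y ∣ < z) → ⊥
  unbounded-multiples y z y≢𝟘 bounded = absurd (archimedean y y≢𝟘) (∣x∣<ι z)
    where
    absurd : ∃[ N ] 𝟙 ≤ ι N * ∣ y ∣ → ∃[ B ] ∣ z ∣ < ι B → ⊥
    absurd (N , 𝟙≤N∣y∣) (B , ∣z∣<B) = ≤⇒≯ (<⇒≤ ∣z∣<B) (≤-<-trans B≤ (<-≤-trans (bounded (B ℕ.* N)) (x≤∣x∣ z)))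
      where
      B≤ : ι B ≤ ι (suc (B ℕ.* N)) * ∣ y ∣
      B≤ = ≤-trans (x≤x*y (ι-nonNeg B) 𝟙≤N∣y∣)
             (subst (_≤ ι (suc (B ℕ.* N)) * ∣ y ∣)
                    (trans (cong (_* ∣ y ∣) (ι-* B N)) (*-assoc (ι B) (ι N) ∣ y ∣))
                    (*-monoʳ-≤ (∣x∣-nonNeg y) (ι-mono-≤ (ℕₚ.n≤1+n (B ℕ.* N)))))

  bounded-multiples⇒≡𝟘 : ∀ y z → (∀ J → ι (suc J) * ∣ y ∣ < z) → y ≡ 𝟘
  bounded-multiples⇒≡𝟘 y z bounded with pos⊎≡𝟘⊎neg y
  ... | inj₂ (inj₁ y≡𝟘) = y≡𝟘
  ... | inj₁ py         = ⊥-elim (unbounded-multiples y z (pos⇒≢𝟘 py) bounded)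
  ... | inj₂ (inj₂ ny)  = ⊥-elim (unbounded-multiples y z (neg⇒≢𝟘 ny) bounded)

  pos⇒archimedean : ∀ {x} → Positive x → ∃[ N ] 𝟙 ≤ ι N * x
  pos⇒archimedean {x} px = lift (archimedean x (pos⇒≢𝟘 px))
    where
    lift : ∃[ N ] 𝟙 ≤ ι N * ∣ x ∣ → ∃[ N ] 𝟙 ≤ ι N * x
    lift (N , h) = N , subst (λ z → 𝟙 ≤ ι N * z) (∣x∣≡x (pos⇒nonNeg px)) h

  eventually-pos : (u : ℕ → ZX n) → (∀ k → u k + 𝟙 ≤ u (3 ℕ.+ k)) → ∃[ K ] (∀ k → K ℕ.≤ k → Positive (u k))
  eventually-pos u step = from-bounds (∣x∣<ι (u 0)) (∣x∣<ι (u 1)) (∣x∣<ι (u 2))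
    where
    from-bounds : ∃[ B ] ∣ u 0 ∣ < ι B → ∃[ B ] ∣ u 1 ∣ < ι B → ∃[ B ] ∣ u 2 ∣ < ι B →
                  ∃[ K ] (∀ k → K ℕ.≤ k → Positive (u k))
    from-bounds (B₀ , h₀) (B₁ , h₁) (B₂ , h₂) = suc B ℕ.* 3 , λ k K≤k → 𝟙≤⇒pos (≤-trans (𝟙≤ k K≤k) (grows k))
      where
      B = B₀ ℕ.+ B₁ ℕ.+ B₂
      base : ∀ {r Bʳ} → Bʳ ℕ.≤ B → ∣ u r ∣ < ι Bʳ → 𝟘 - ι B ≤ u r
      base {r} Bʳ≤B ∣ur∣<Bʳ = subst NonNeg (solve 2 (λ x B → B :- (:- x) := x :- (con (+ 0) :- B)) refl (u r) (ι B))
                                    (<⇒≤ (≤-<-trans (-x≤∣x∣ (u r)) (<-≤-trans ∣ur∣<Bʳ (ι-mono-≤ Bʳ≤B))))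
      grows : ∀ k → ι ⌊ k /3⌋ - ι B ≤ u k
      grows = induction-mod-3 (base (m≤m+n+o B₀ B₁ B₂) h₀) (base (n≤m+n+o B₀ B₁ B₂) h₁) (base (o≤m+n+o B₀ B₁ B₂) h₂)
        λ k h → ≤-trans (subst (_≤ u k + 𝟙) (sym (trans (cong (_- ι B) (ι-+ 1 ⌊ k /3⌋))
                                                       (solve 2 (λ j B → con (+ 1) :+ j :- B := (j :- B) :+ con (+ 1)) refl _ _)))
                                (+-mono-≤ h ≤-refl))
                         (step k)
      𝟙≤ : ∀ k → suc B ℕ.* 3 ℕ.≤ k → 𝟙 ≤ ι ⌊ k /3⌋ - ι B
      𝟙≤ k K≤k = subst (_≤ ι ⌊ k /3⌋ - ι B)
                       (trans (cong (_- ι B) (ι-+ 1 B)) (solve 1 (λ B → con (+ 1) :+ B :- B := con (+ 1)) refl (ι B)))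
                       (+-mono-≤ (ι-mono-≤ (m*3≤k⇒m≤⌊k/3⌋ (suc B) k K≤k)) ≤-refl)

  uniformly-bounded-below : (v : ℕ → ZX n) → (∀ k → v k ≤ v (3 ℕ.+ k)) →
                            Positive (v 0) → Positive (v 1) → Positive (v 2) → ∃[ N ] (∀ k → 𝟙 ≤ ι N * v k)
  uniformly-bounded-below v step p₀ p₁ p₂ = from-bounds (pos⇒archimedean p₀) (pos⇒archimedean p₁) (pos⇒archimedean p₂)
    where
    from-bounds : ∃[ N ] 𝟙 ≤ ι N * v 0 → ∃[ N ] 𝟙 ≤ ι N * v 1 → ∃[ N ] 𝟙 ≤ ι N * v 2 → ∃[ N ] (∀ k → 𝟙 ≤ ι N * v k)
    from-bounds (N₀ , h₀) (N₁ , h₁) (N₂ , h₂) =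
      N , induction-mod-3 (raise (m≤m+n+o N₀ N₁ N₂) p₀ h₀) (raise (n≤m+n+o N₀ N₁ N₂) p₁ h₁) (raise (o≤m+n+o N₀ N₁ N₂) p₂ h₂)
                          λ k h → ≤-trans h (*-monoˡ-≤ (ι-nonNeg N) (step k))
      where
      N = N₀ ℕ.+ N₁ ℕ.+ N₂
      raise : ∀ {Nʳ x} → Nʳ ℕ.≤ N → Positive x → 𝟙 ≤ ι Nʳ * x → 𝟙 ≤ ι N * x
      raise Nʳ≤N px h = ≤-trans h (*-monoʳ-≤ (pos⇒nonNeg px) (ι-mono-≤ Nʳ≤N))

module Convergents (m : ℕ) where
  open OrderedRing (Invariant.signLaws (invariant m))

  matMul-assoc : ∀ A B C → matMul m (matMul m A B) C ≡ matMul m A (matMul m B C)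
  matMul-assoc (mat a₁₁ a₁₂ a₂₁ a₂₂) (mat b₁₁ b₁₂ b₂₁ b₂₂) (mat c₁₁ c₁₂ c₂₁ c₂₂) =
    cong₂ (λ (u v : ZX m × ZX m) → mat (proj₁ u) (proj₂ u) (proj₁ v) (proj₂ v))
      (cong₂ _,_ (entry a₁₁ a₁₂ c₁₁ c₂₁) (entry a₁₁ a₁₂ c₁₂ c₂₂))
      (cong₂ _,_ (entry a₂₁ a₂₂ c₁₁ c₂₁) (entry a₂₁ a₂₂ c₁₂ c₂₂))
    where
    entry : ∀ a₁ a₂ c₁ c₂ → (a₁ * b₁₁ + a₂ * b₂₁) * c₁ + (a₁ * b₁₂ + a₂ * b₂₂) * c₂
                          ≡ a₁ * (b₁₁ * c₁ + b₁₂ * c₂) + a₂ * (b₂₁ * c₁ + b₂₂ * c₂)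
    entry a₁ a₂ c₁ c₂ = solve 8 (λ a₁ a₂ b₁₁ b₁₂ b₂₁ b₂₂ c₁ c₂ →
      (a₁ :* b₁₁ :+ a₂ :* b₂₁) :* c₁ :+ (a₁ :* b₁₂ :+ a₂ :* b₂₂) :* c₂
      := a₁ :* (b₁₁ :* c₁ :+ b₁₂ :* c₂) :+ a₂ :* (b₂₁ :* c₁ :+ b₂₂ :* c₂)) refl a₁ a₂ b₁₁ b₁₂ b₂₁ b₂₂ c₁ c₂

  convMat-period : ∀ c → (∀ k → c (3 ℕ.+ k) ≡ c k) →
                   ∀ k → convMat m c (3 ℕ.+ k) ≡ matMul m (convMat m c 2) (convMat m c k)
  convMat-period c periodic zero    = cong (λ z → matMul m (convMat m c 2) (step m z)) (periodic 0)
  convMat-period c periodic (suc k) =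
    trans (cong₂ (λ A z → matMul m A (step m z)) (convMat-period c periodic k) (periodic (suc k)))
          (matMul-assoc (convMat m c 2) (convMat m c k) (step m (c (suc k))))

  module Period (a₁ a₂ a₃ : ZX m) where
    c : ℕ → ZX m
    c = cyc3 a₁ a₂ a₃

    M : Mat (ZX m)
    M = convMat m c 2

    P Q : ℕ → ZX m
    P = pconv m c
    Q = qconv m c

    M₁₁≡ : m11 M ≡ (a₁ * a₂ + 𝟙) * a₃ + a₁
    M₁₁≡ = solve 3 (λ a₁ a₂ a₃ → (a₁ :* a₂ :+ con (+ 1) :* con (+ 1)) :* a₃ :+ (a₁ :* con (+ 1) :+ con (+ 1) :* con (+ 0)) :* con (+ 1)
                              := (a₁ :* a₂ :+ con (+ 1)) :* a₃ :+ a₁) refl a₁ a₂ a₃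
    M₁₂≡ : m12 M ≡ a₁ * a₂ + 𝟙
    M₁₂≡ = solve 2 (λ a₁ a₂ → (a₁ :* a₂ :+ con (+ 1) :* con (+ 1)) :* con (+ 1) :+ (a₁ :* con (+ 1) :+ con (+ 1) :* con (+ 0)) :* con (+ 0)
                           := a₁ :* a₂ :+ con (+ 1)) refl a₁ a₂
    M₂₁≡ : m21 M ≡ a₂ * a₃ + 𝟙
    M₂₁≡ = solve 2 (λ a₂ a₃ → (con (+ 1) :* a₂ :+ con (+ 0) :* con (+ 1)) :* a₃ :+ (con (+ 1) :* con (+ 1) :+ con (+ 0) :* con (+ 0)) :* con (+ 1)
                           := a₂ :* a₃ :+ con (+ 1)) refl a₂ a₃
    M₂₂≡ : m22 M ≡ a₂
    M₂₂≡ = solve 1 (λ a₂ → (con (+ 1) :* a₂ :+ con (+ 0) :* con (+ 1)) :* con (+ 1) :+ (con (+ 1) :* con (+ 1) :+ con (+ 0) :* con (+ 0)) :* con (+ 0)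
                        := a₂) refl a₂

    Q₁≡a₂ : Q 1 ≡ a₂
    Q₁≡a₂ = solve 1 (λ a₂ → con (+ 1) :* a₂ :+ con (+ 0) :* con (+ 1) := a₂) refl a₂

    P-period : ∀ k → P (3 ℕ.+ k) ≡ m11 M * P k + m12 M * Q k
    P-period k = cong m11 (convMat-period c (λ _ → refl) k)

    Q-period : ∀ k → Q (3 ℕ.+ k) ≡ m21 M * P k + m22 M * Q k
    Q-period k = cong m21 (convMat-period c (λ _ → refl) k)

    det≡-1 : m11 M * m22 M - m12 M * m21 M ≡ - 𝟙
    det≡-1 = begin
      m11 M * m22 M - m12 M * m21 M
        ≡⟨ cong₂ (λ x y → x * m22 M - y) M₁₁≡ (cong₂ _*_ M₁₂≡ M₂₁≡) ⟩
      ((a₁ * a₂ + 𝟙) * a₃ + a₁) * m22 M - (a₁ * a₂ + 𝟙) * (a₂ * a₃ + 𝟙)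
        ≡⟨ cong (λ z → ((a₁ * a₂ + 𝟙) * a₃ + a₁) * z - (a₁ * a₂ + 𝟙) * (a₂ * a₃ + 𝟙)) M₂₂≡ ⟩
      ((a₁ * a₂ + 𝟙) * a₃ + a₁) * a₂ - (a₁ * a₂ + 𝟙) * (a₂ * a₃ + 𝟙)
        ≡⟨ solve 3 (λ a₁ a₂ a₃ → ((a₁ :* a₂ :+ con (+ 1)) :* a₃ :+ a₁) :* a₂ :- (a₁ :* a₂ :+ con (+ 1)) :* (a₂ :* a₃ :+ con (+ 1))
                                := :- con (+ 1)) refl a₁ a₂ a₃ ⟩
      - 𝟙 ∎
      where open ≡-Reasoning

module ContinuedFraction (m : ℕ) where
  open Archimedean (invariant (suc m)) hiding (solve; con; _:+_; _:*_; _:-_; :-_; _:=_)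
  open InvariantStep (invariant m) using (X; X-pos; X<2; 𝟙<X; sign-emb)
  open Convergents m using (module Period)
  module B = OrderedRing (Invariant.signLaws (invariant m))
  module LS = Solver (suc m)
  open Solver m using (solve; con; _:+_; _:*_; _:-_; :-_; _:=_)

  d : ZX m
  d = genSq m

  -- e_k = P_k - X Q_k, f_k = P_k + X Q_k and W_k = Q_k, as elements of ℤ[X_{m+1}].
  e f W : (ℕ → ZX m) → ℕ → ZX (suc m)
  e c k = pconv m c k , B.- qconv m c k
  f c k = pconv m c k , qconv m c k
  W c k = qconv m c k , B.𝟘

  Close : (ℕ → ZX m) → ℕ → ℕ → Set
  Close c J k = qconv m c k ≢ B.𝟘 × ι (suc J) * ∣ e c k ∣ < ∣ W c k ∣

  EventuallyClose : (ℕ → ZX m) → Set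
  EventuallyClose c = ∀ J → ∃[ K ] (∀ k → K ℕ.≤ k → Close c J k)

  P-XQ≡e : ∀ P Q → sub (suc m) (emb m P) (X * emb m Q) ≡ (P , B.- Q)
  P-XQ≡e P Q = cong₂ _,_
    (solve 3 (λ P Q d → P :+ :- (con (+ 0) :* Q :+ con (+ 1) :* con (+ 0) :* d) := P) refl P Q d)
    (solve 1 (λ Q → con (+ 0) :+ :- (con (+ 0) :* con (+ 0) :+ con (+ 1) :* Q) := :- Q) refl Q)

  fromCFEqualsX : ∀ c → CFEqualsX m c → EventuallyClose c
  fromCFEqualsX c h J = map₂ (λ close k K≤k → map₂ (subst (λ z → ι (suc J) * ∣ z ∣ < ∣ W c k ∣) (P-XQ≡e _ _))
                                                   (close k K≤k))
                             (h J)

  toCFEqualsX : ∀ c → EventuallyClose c → CFEqualsX m c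
  toCFEqualsX c h J = map₂ (λ close k K≤k → map₂ (subst (λ z → ι (suc J) * ∣ z ∣ < ∣ W c k ∣) (sym (P-XQ≡e _ _)))
                                                 (close k K≤k))
                           (h J)

  pair≡conj+2XQ : ∀ P Q → (P , Q) ≡ (P , B.- Q) + (X + X) * (Q , B.𝟘)
  pair≡conj+2XQ P Q = sym (cong₂ _,_
    (solve 3 (λ P Q d → P :+ ((con (+ 0) :+ con (+ 0)) :* Q :+ (con (+ 1) :+ con (+ 1)) :* con (+ 0) :* d) := P) refl P Q d)
    (solve 1 (λ Q → :- Q :+ ((con (+ 0) :+ con (+ 0)) :* con (+ 0) :+ (con (+ 1) :+ con (+ 1)) :* Q) := Q) refl Q))

  2X-pos : Positive (X + X)
  2X-pos = pos-add _ _ X-pos X-pos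

  2X≤4 : X + X ≤ ι 4
  2X≤4 = pos⇒nonNeg (subst Positive
    (LS.solve 1 (λ X → LS.con (+ 2) LS.:* (LS.con (+ 2) LS.:- X) LS.:= LS.con (+ 4) LS.:- (X LS.:+ X)) refl X)
    (pos*pos (sign-fromℤ (+ 2)) X<2))

  2≤2X : ι 2 ≤ X + X
  2≤2X = subst (_≤ X + X) (sym (ι-+ 1 1)) (+-mono-≤ (<⇒≤ 𝟙<X) (<⇒≤ 𝟙<X))

  ∣2XQ∣ : ∀ Q → ∣ (X + X) * (Q , B.𝟘) ∣ ≡ (X + X) * ∣ (Q , B.𝟘) ∣
  ∣2XQ∣ Q = trans (∣x*y∣≡∣x∣*∣y∣ _ _) (cong (_* ∣ (Q , B.𝟘) ∣) (∣x∣≡x (pos⇒nonNeg 2X-pos)))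

  C : ℕ → ZX (suc m)
  C J = 𝟙 + ι 4 * ι (suc J)

  close-of-dominated : ∀ J P Q → C J * ∣ (P , B.- Q) ∣ < ∣ (P , Q) ∣ →
                       Q ≢ B.𝟘 × ι (suc J) * ∣ (P , B.- Q) ∣ < ∣ (Q , B.𝟘) ∣
  close-of-dominated J P Q h = Q≢𝟘 , ta<w
    where
    t a w : ZX (suc m)
    t = ι (suc J)
    a = ∣ (P , B.- Q) ∣
    w = ∣ (Q , B.𝟘) ∣
    ta-nonNeg : NonNeg (t * a)
    ta-nonNeg = nonNeg*nonNeg (ι-nonNeg (suc J)) (∣x∣-nonNeg _)
    4ta<2Xw : ι 4 * (t * a) < (X + X) * w
    4ta<2Xw = +-cancelˡ-< (begin-strict
      a + ι 4 * (t * a)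
        ≡⟨ LS.solve 3 (λ a F t → a LS.:+ F LS.:* (t LS.:* a) LS.:= (LS.con (+ 1) LS.:+ F LS.:* t) LS.:* a) refl a (ι 4) t ⟩
      C J * a                  <⟨ h ⟩
      ∣ (P , Q) ∣              ≡⟨ cong ∣_∣ (pair≡conj+2XQ P Q) ⟩
      ∣ (P , B.- Q) + (X + X) * (Q , B.𝟘) ∣ ≤⟨ ∣∣-triangle _ _ ⟩
      a + ∣ (X + X) * (Q , B.𝟘) ∣          ≡⟨ cong (λ z → a + z) (∣2XQ∣ Q) ⟩
      a + (X + X) * w          ∎)
      where open ≤-Reasoning
    ta<w : t * a < w
    ta<w = *-cancelˡ-< 2X-pos (≤-<-trans (*-monoʳ-≤ ta-nonNeg 2X≤4) 4ta<2Xw)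
    Q≢𝟘 : Q ≢ B.𝟘
    Q≢𝟘 refl = ≤⇒≯ (subst (_≤ t * a) (sym (∣x∣≡x nonNeg-𝟘)) (nonNeg⇒𝟘≤ ta-nonNeg)) ta<w

  close⇒<∣f∣ : ∀ J P Q → ι (suc J) * ∣ (P , B.- Q) ∣ < ∣ (Q , B.𝟘) ∣ → ι (suc J) * ∣ (P , B.- Q) ∣ < ∣ (P , Q) ∣
  close⇒<∣f∣ J P Q ta<w = +-cancelˡ-< (subst₂ _<_ (+-comm _ _) (+-comm _ _) (begin-strict
    t * a + t * a              ≡⟨ LS.solve 1 (λ y → y LS.:+ y LS.:= LS.con (+ 2) LS.:* y) refl (t * a) ⟩
    ι 2 * (t * a)              ≤⟨ *-monoʳ-≤ ta-nonNeg 2≤2X ⟩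
    (X + X) * (t * a)          <⟨ *-monoˡ-< 2X-pos ta<w ⟩
    (X + X) * w                ≡⟨ sym (∣2XQ∣ Q) ⟩
    ∣ (X + X) * (Q , B.𝟘) ∣     ≡⟨ cong ∣_∣ 2XW≡f-e ⟩
    ∣ (P , Q) + - (P , B.- Q) ∣ ≤⟨ ∣∣-triangle _ _ ⟩
    ∣ (P , Q) ∣ + ∣ - (P , B.- Q) ∣ ≡⟨ cong (λ z → ∣ (P , Q) ∣ + z) (∣-x∣≡∣x∣ _) ⟩
    ∣ (P , Q) ∣ + a            ≤⟨ +-mono-≤ ≤-refl (x≤ι-suc*x J (∣x∣-nonNeg _)) ⟩
    ∣ (P , Q) ∣ + t * a        ∎))
    where
    open ≤-Reasoning
    t a w : ZX (suc m)
    t = ι (suc J)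
    a = ∣ (P , B.- Q) ∣
    w = ∣ (Q , B.𝟘) ∣
    ta-nonNeg : NonNeg (t * a)
    ta-nonNeg = nonNeg*nonNeg (ι-nonNeg (suc J)) (∣x∣-nonNeg _)
    2XW≡f-e : (X + X) * (Q , B.𝟘) ≡ (P , Q) + - (P , B.- Q)
    2XW≡f-e = trans (LS.solve 2 (λ e y → y LS.:= (e LS.:+ y) LS.:+ LS.:- e) refl (P , B.- Q) _)
                    (cong (_+ - (P , B.- Q)) (sym (pair≡conj+2XQ P Q)))

  module UnitPeriod (c : ℕ → ZX m) (p q : ZX m)
    (P-period : ∀ k → pconv m c (3 ℕ.+ k) ≡ p B.* pconv m c k B.+ (d B.* q) B.* qconv m c k)
    (Q-period : ∀ k → qconv m c (3 ℕ.+ k) ≡ q B.* pconv m c k B.+ p B.* qconv m c k)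
    (N≡-1 : relNorm m (p , q) ≡ B.- B.𝟙) where

    ε ε̄ : ZX (suc m)
    ε = p , q
    ε̄ = p , B.- q

    f-period : ∀ k → f c (3 ℕ.+ k) ≡ ε * f c k
    f-period k = cong₂ _,_
      (trans (P-period k) (solve 5 (λ p q P Q d → p :* P :+ (d :* q) :* Q := p :* P :+ q :* Q :* d)
                                     refl p q (pconv m c k) (qconv m c k) d))
      (trans (Q-period k) (solve 4 (λ p q P Q → q :* P :+ p :* Q := p :* Q :+ q :* P)
                                     refl p q (pconv m c k) (qconv m c k)))

    e-period : ∀ k → e c (3 ℕ.+ k) ≡ ε̄ * e c k
    e-period k = cong₂ _,_
      (trans (P-period k) (solve 5 (λ p q P Q d → p :* P :+ (d :* q) :* Q := p :* P :+ (:- q) :* (:- Q) :* d)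
                                     refl p q (pconv m c k) (qconv m c k) d))
      (trans (cong B.-_ (Q-period k)) (solve 4 (λ p q P Q → :- (q :* P :+ p :* Q) := p :* (:- Q) :+ (:- q) :* P)
                                                 refl p q (pconv m c k) (qconv m c k)))

    ε*ε̄≡-𝟙 : ε * ε̄ ≡ - 𝟙
    ε*ε̄≡-𝟙 = cong₂ _,_
      (trans (solve 3 (λ p q d → p :* p :+ q :* (:- q) :* d := p :* p :- d :* (q :* q)) refl p q d) N≡-1)
      (solve 2 (λ p q → p :* (:- q) :+ q :* p := :- con (+ 0)) refl p q)

    ∣ε∣*∣ε̄∣≡𝟙 : ∣ ε ∣ * ∣ ε̄ ∣ ≡ 𝟙
    ∣ε∣*∣ε̄∣≡𝟙 = begin
      ∣ ε ∣ * ∣ ε̄ ∣    ≡⟨ sym (∣x*y∣≡∣x∣*∣y∣ ε ε̄) ⟩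
      ∣ ε * ε̄ ∣        ≡⟨ cong ∣_∣ ε*ε̄≡-𝟙 ⟩
      ∣ - 𝟙 ∣          ≡⟨ ∣-x∣≡∣x∣ 𝟙 ⟩
      ∣ 𝟙 ∣            ≡⟨ ∣x∣≡x (pos⇒nonNeg 𝟙-pos) ⟩
      𝟙                ∎
      where open ≡-Reasoning

    ∣f∣-period : ∀ k → ∣ f c (3 ℕ.+ k) ∣ ≡ ∣ ε ∣ * ∣ f c k ∣
    ∣f∣-period k = trans (cong ∣_∣ (f-period k)) (∣x*y∣≡∣x∣*∣y∣ _ _)

    ∣e∣-period : ∀ k → ∣ e c (3 ℕ.+ k) ∣ ≡ ∣ ε̄ ∣ * ∣ e c k ∣
    ∣e∣-period k = trans (cong ∣_∣ (e-period k)) (∣x*y∣≡∣x∣*∣y∣ _ _)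

    -- |ε|² - |ε̄|² = ε² - ε̄² = 4 X p q
    sign-∣ε∣²-∣ε̄∣² : sign (suc m) (∣ ε ∣ * ∣ ε ∣ - ∣ ε̄ ∣ * ∣ ε̄ ∣) ≡ sign m (p B.* q)
    sign-∣ε∣²-∣ε̄∣² = begin
      sign (suc m) (∣ ε ∣ * ∣ ε ∣ - ∣ ε̄ ∣ * ∣ ε̄ ∣) ≡⟨ cong (sign (suc m)) (trans (cong₂ _-_ (∣x∣²≡x² ε) (∣x∣²≡x² ε̄)) ε²-ε̄²) ⟩
      sign (suc m) (X * (4pq , B.𝟘))               ≡⟨ sign-pos* _ X-pos ⟩
      sign (suc m) (4pq , B.𝟘)                     ≡⟨ sign-emb 4pq ⟩
      sign m 4pq                                   ≡⟨ B.sign-pos* (p B.* q) (B.sign-fromℤ (+ 4)) ⟩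
      sign m (p B.* q)                             ∎
      where
      open ≡-Reasoning
      4pq : ZX m
      4pq = fromℤ m (+ 4) B.* (p B.* q)
      ε²-ε̄² : ε * ε - ε̄ * ε̄ ≡ X * (4pq , B.𝟘)
      ε²-ε̄² = cong₂ _,_
        (solve 3 (λ p q d → p :* p :+ q :* q :* d :+ :- (p :* p :+ (:- q) :* (:- q) :* d)
                   := con (+ 0) :* (con (+ 4) :* (p :* q)) :+ con (+ 1) :* con (+ 0) :* d) refl p q d)
        (solve 2 (λ p q → p :* q :+ q :* p :+ :- (p :* (:- q) :+ (:- q) :* p)
                   := con (+ 0) :* con (+ 0) :+ con (+ 1) :* (con (+ 4) :* (p :* q))) refl p q)

    open ProductOne (∣x∣-nonNeg ε) (∣x∣-nonNeg ε̄) ∣ε∣*∣ε̄∣≡𝟙 public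

  module Converse (p q b₁ b₃ : ZX m)
    (N≡-1 : relNorm m (p , q) ≡ B.- B.𝟙)
    (h₁ : p B.* b₁ ≡ d B.* q B.- B.𝟙)
    (h₃ : p B.* b₃ ≡ q B.- B.𝟙)
    (pq-pos : Pos m (p B.* q)) where
    open Period b₁ p b₃

    p≢𝟘 : p ≢ B.𝟘
    p≢𝟘 refl = B.pos⇒≢𝟘 pq-pos (solve 1 (λ q → con (+ 0) :* q := con (+ 0)) refl q)

    q≢𝟘 : q ≢ B.𝟘
    q≢𝟘 refl = B.pos⇒≢𝟘 pq-pos (solve 1 (λ p → p :* con (+ 0) := con (+ 0)) refl p)

    M₁₂≡dq : m12 M ≡ d B.* q
    M₁₂≡dq = trans M₁₂≡ (trans (cong (B._+ B.𝟙) (trans (B.*-comm b₁ p) h₁))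
                               (solve 2 (λ d q → d :* q :- con (+ 1) :+ con (+ 1) := d :* q) refl d q))

    M₂₁≡q : m21 M ≡ q
    M₂₁≡q = trans M₂₁≡ (trans (cong (B._+ B.𝟙) h₃) (solve 1 (λ q → q :- con (+ 1) :+ con (+ 1) := q) refl q))

    p²≡dq²-𝟙 : p B.* p ≡ d B.* (q B.* q) B.- B.𝟙
    p²≡dq²-𝟙 = begin
      p B.* p                                              ≡⟨ solve 3 (λ p d q → p :* p := (p :* p :- d :* (q :* q)) :+ d :* (q :* q)) refl p d q ⟩
      (p B.* p B.- d B.* (q B.* q)) B.+ d B.* (q B.* q)   ≡⟨ cong (B._+ d B.* (q B.* q)) N≡-1 ⟩
      B.- B.𝟙 B.+ d B.* (q B.* q)                         ≡⟨ B.+-comm _ _ ⟩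
      d B.* (q B.* q) B.- B.𝟙                             ∎
      where open ≡-Reasoning

    M₁₁≡p : m11 M ≡ p
    M₁₁≡p = B.*-cancelˡ-≡ p≢𝟘 (begin
      p B.* m11 M                                         ≡⟨ cong (p B.*_) M₁₁≡ ⟩
      p B.* ((b₁ B.* p B.+ B.𝟙) B.* b₃ B.+ b₁)
        ≡⟨ solve 3 (λ p b₁ b₃ → p :* ((b₁ :* p :+ con (+ 1)) :* b₃ :+ b₁)
                                := (p :* b₁ :+ con (+ 1)) :* (p :* b₃) :+ p :* b₁) refl p b₁ b₃ ⟩
      (p B.* b₁ B.+ B.𝟙) B.* (p B.* b₃) B.+ p B.* b₁       ≡⟨ cong₂ (λ x y → (x B.+ B.𝟙) B.* y B.+ x) h₁ h₃ ⟩
      (d B.* q B.- B.𝟙 B.+ B.𝟙) B.* (q B.- B.𝟙) B.+ (d B.* q B.- B.𝟙)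
        ≡⟨ solve 2 (λ d q → (d :* q :- con (+ 1) :+ con (+ 1)) :* (q :- con (+ 1)) :+ (d :* q :- con (+ 1))
                              := d :* (q :* q) :- con (+ 1)) refl d q ⟩
      d B.* (q B.* q) B.- B.𝟙                             ≡⟨ sym p²≡dq²-𝟙 ⟩
      p B.* p                                             ∎)
      where open ≡-Reasoning

    open UnitPeriod c p q (λ k → trans (P-period k) (cong₂ (λ x y → x B.* P k B.+ y B.* Q k) M₁₁≡p M₁₂≡dq))
                          (λ k → trans (Q-period k) (cong₂ (λ x y → x B.* P k B.+ y B.* Q k) M₂₁≡q M₂₂≡)) N≡-1

    β<𝟙<α : ∣ ε̄ ∣ < 𝟙 × 𝟙 < ∣ ε ∣
    β<𝟙<α = β<α⇒β<𝟙<α (squares-<⇒< ∣ ε ∣ ∣ ε̄ ∣ (trans sign-∣ε∣²-∣ε̄∣² pq-pos)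
                                    (∣x∣-pos (λ ε≡𝟘 → q≢𝟘 (cong proj₂ ε≡𝟘))))

    ∣f∣-pos : ∀ k → qconv m c k ≢ B.𝟘 → Positive ∣ f c k ∣
    ∣f∣-pos k Q≢𝟘 = ∣x∣-pos (λ f≡𝟘 → Q≢𝟘 (cong proj₂ f≡𝟘))

    ∣f∣-bounded-below : ∃[ N ] (∀ k → 𝟙 ≤ ι N * ∣ f c k ∣)
    ∣f∣-bounded-below = uniformly-bounded-below (λ k → ∣ f c k ∣) grows
      (∣f∣-pos 0 B.𝟙≢𝟘) (∣f∣-pos 1 (λ Q₁≡𝟘 → p≢𝟘 (trans (sym Q₁≡a₂) Q₁≡𝟘)))
      (∣f∣-pos 2 (λ Q₂≡𝟘 → q≢𝟘 (trans (sym M₂₁≡q) Q₂≡𝟘)))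
      where
      grows : ∀ k → ∣ f c k ∣ ≤ ∣ f c (3 ℕ.+ k) ∣
      grows k = subst (∣ f c k ∣ ≤_) (trans (*-comm _ _) (sym (∣f∣-period k)))
                      (x≤x*y (∣x∣-nonNeg (f c k)) (<⇒≤ (proj₂ β<𝟙<α)))

    module Growth (J N N′ : ℕ) (lower : ∀ k → 𝟙 ≤ ι N * ∣ f c k ∣) (α-𝟙-lower : 𝟙 ≤ ι N′ * ∣ ∣ ε ∣ - 𝟙 ∣) where
      α β T : ZX (suc m)
      α = ∣ ε ∣
      β = ∣ ε̄ ∣
      T = ι N′ * ι N

      D : ℕ → ZX (suc m)
      D k = ∣ f c k ∣ - C J * ∣ e c k ∣

      T-nonNeg : NonNeg T
      T-nonNeg = nonNeg*nonNeg (ι-nonNeg N′) (ι-nonNeg N)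

      -- |f_k| grows by the factor α > 1 while |e_k| shrinks by β < 1, and α - 1 and |f_k| are bounded below.
      grows : ∀ k → T * D k + 𝟙 ≤ T * D (3 ℕ.+ k)
      grows k = subst NonNeg (sym increment) (nonNeg+nonNeg (𝟙≤* α-𝟙-lower′ (lower k)) rest-nonNeg)
        where
        fk ek : ZX (suc m)
        fk = ∣ f c k ∣
        ek = ∣ e c k ∣
        α-𝟙-lower′ : 𝟙 ≤ ι N′ * (α - 𝟙)
        α-𝟙-lower′ = subst (λ z → 𝟙 ≤ ι N′ * z) (∣x∣≡x (pos⇒nonNeg (proj₂ β<𝟙<α))) α-𝟙-lower
        rest-nonNeg : NonNeg (T * (C J * ((𝟙 - β) * ek)))
        rest-nonNeg = nonNeg*nonNeg T-nonNeg
          (nonNeg*nonNeg (pos⇒nonNeg (pos+nonNeg 𝟙-pos (nonNeg*nonNeg (ι-nonNeg 4) (ι-nonNeg (suc J)))))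
                         (nonNeg*nonNeg (pos⇒nonNeg (proj₁ β<𝟙<α)) (∣x∣-nonNeg _)))
        increment : T * D (3 ℕ.+ k) - (T * D k + 𝟙) ≡ (ι N′ * (α - 𝟙)) * (ι N * fk) - 𝟙 + T * (C J * ((𝟙 - β) * ek))
        increment = begin
          T * D (3 ℕ.+ k) - (T * D k + 𝟙)
            ≡⟨ cong₂ (λ x y → T * (x - C J * y) - (T * D k + 𝟙)) (∣f∣-period k) (∣e∣-period k) ⟩
          T * (α * fk - C J * (β * ek)) - (T * (fk - C J * ek) + 𝟙)
            ≡⟨ LS.solve 7 (λ A B′ N′ N C′ F E →
                 (N′ LS.:* N) LS.:* (A LS.:* F LS.:- C′ LS.:* (B′ LS.:* E))
                   LS.:- ((N′ LS.:* N) LS.:* (F LS.:- C′ LS.:* E) LS.:+ LS.con (+ 1))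
                 LS.:= (N′ LS.:* (A LS.:- LS.con (+ 1))) LS.:* (N LS.:* F) LS.:- LS.con (+ 1)
                         LS.:+ (N′ LS.:* N) LS.:* (C′ LS.:* ((LS.con (+ 1) LS.:- B′) LS.:* E)))
                 refl α β (ι N′) (ι N) (C J) fk ek ⟩
          (ι N′ * (α - 𝟙)) * (ι N * fk) - 𝟙 + T * (C J * ((𝟙 - β) * ek)) ∎
          where open ≡-Reasoning

    eventually-dominated : ∀ J → ∃[ K ] (∀ k → K ℕ.≤ k → C J * ∣ e c k ∣ < ∣ f c k ∣)
    eventually-dominated J = from-bounds ∣f∣-bounded-below (archimedean (∣ ε ∣ - 𝟙) (pos⇒≢𝟘 (proj₂ β<𝟙<α)))
      where
      from-bounds : ∃[ N ] (∀ k → 𝟙 ≤ ι N * ∣ f c k ∣) → ∃[ N′ ] 𝟙 ≤ ι N′ * ∣ ∣ ε ∣ - 𝟙 ∣ →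
                    ∃[ K ] (∀ k → K ℕ.≤ k → C J * ∣ e c k ∣ < ∣ f c k ∣)
      from-bounds (N , lower) (N′ , α-𝟙-lower) =
        map₂ (λ T*D-pos k K≤k → nonNeg*y-pos⇒pos T-nonNeg (T*D-pos k K≤k)) (eventually-pos _ grows)
        where open Growth J N N′ lower α-𝟙-lower

    eventually-close : EventuallyClose c
    eventually-close J = map₂ (λ dominated k K≤k → close-of-dominated J (pconv m c k) (qconv m c k) (dominated k K≤k))
                              (eventually-dominated J)

  module Forward (a₁ a₂ a₃ : ZX m) (close : EventuallyClose (cyc3 a₁ a₂ a₃)) where
    open Period a₁ a₂ a₃

    μ γ ν M₂₁′ : ZX (suc m)
    μ   = m11 M , B.- m21 M
    γ   = m12 M B.- d B.* m21 M , m11 M B.- m22 M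
    ν   = m22 M , m21 M
    M₂₁′ = m21 M , B.𝟘

    e-period : ∀ k → e c (3 ℕ.+ k) ≡ μ * e c k + γ * W c k
    e-period k = cong₂ _,_
      (trans (P-period k) (solve 7 (λ a b e f P Q d → a :* P :+ b :* Q
          := (a :* P :+ (:- e) :* (:- Q) :* d) :+ ((b :- d :* e) :* Q :+ (a :- f) :* con (+ 0) :* d))
          refl (m11 M) (m12 M) (m21 M) (m22 M) (P k) (Q k) d))
      (trans (cong B.-_ (Q-period k)) (solve 7 (λ a b e f P Q d → :- (e :* P :+ f :* Q)
          := (a :* (:- Q) :+ (:- e) :* P) :+ ((b :- d :* e) :* con (+ 0) :+ (a :- f) :* Q))
          refl (m11 M) (m12 M) (m21 M) (m22 M) (P k) (Q k) d))

    W-period : ∀ k → W c (3 ℕ.+ k) ≡ M₂₁′ * e c k + ν * W c k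
    W-period k = cong₂ _,_
      (trans (Q-period k) (solve 5 (λ e f P Q d → e :* P :+ f :* Q
          := (e :* P :+ con (+ 0) :* (:- Q) :* d) :+ (f :* Q :+ e :* con (+ 0) :* d))
          refl (m21 M) (m22 M) (P k) (Q k) d))
      (solve 4 (λ e f P Q → con (+ 0) := (e :* (:- Q) :+ con (+ 0) :* P) :+ (f :* con (+ 0) :+ e :* Q))
          refl (m21 M) (m22 M) (P k) (Q k))

    -- γ Q_K = e_{K+3} - μ e_K where e_K and e_{K+3} are o(Q_K), so γ is infinitesimal.
    γ-bounded : ∀ J K → Close c J K → ι (suc J) * ∣ e c (3 ℕ.+ K) ∣ < ∣ W c (3 ℕ.+ K) ∣ →
                ι (suc J) * ∣ γ ∣ < ∣ M₂₁′ ∣ + ∣ ν ∣ + ∣ μ ∣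
    γ-bounded J K (Q≢𝟘 , ta<w) ta′<w′ = *-cancelˡ-< w-pos (begin-strict
      w * (t * ∣ γ ∣)                      ≡⟨ LS.solve 3 (λ w t g → w LS.:* (t LS.:* g) LS.:= t LS.:* (g LS.:* w)) refl w t ∣ γ ∣ ⟩
      t * (∣ γ ∣ * w)                      ≡⟨ cong (t *_) (sym (∣x*y∣≡∣x∣*∣y∣ γ (W c K))) ⟩
      t * ∣ γ * W c K ∣                    ≡⟨ cong (λ z → t * ∣ z ∣) γW≡ ⟩
      t * ∣ e c (3 ℕ.+ K) + - (μ * e c K) ∣ ≤⟨ *-monoˡ-≤ (ι-nonNeg (suc J)) (∣∣-triangle _ _) ⟩
      t * (a′ + ∣ - (μ * e c K) ∣)          ≡⟨ cong (λ z → t * (a′ + z)) (trans (∣-x∣≡∣x∣ _) (∣x*y∣≡∣x∣*∣y∣ μ (e c K))) ⟩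
      t * (a′ + ∣ μ ∣ * a)                  ≡⟨ LS.solve 4 (λ t a′ μ a → t LS.:* (a′ LS.:+ μ LS.:* a) LS.:= t LS.:* a′ LS.:+ μ LS.:* (t LS.:* a)) refl t a′ ∣ μ ∣ a ⟩
      t * a′ + ∣ μ ∣ * (t * a)              <⟨ +-mono-<-≤ ta′<w′ (*-monoˡ-≤ (∣x∣-nonNeg μ) (<⇒≤ ta<w)) ⟩
      w′ + ∣ μ ∣ * w                        ≤⟨ +-mono-≤ w′≤ ≤-refl ⟩
      ∣ M₂₁′ ∣ * w + ∣ ν ∣ * w + ∣ μ ∣ * w  ≡⟨ LS.solve 4 (λ A B C w → A LS.:* w LS.:+ B LS.:* w LS.:+ C LS.:* w LS.:= w LS.:* (A LS.:+ B LS.:+ C)) refl (∣ M₂₁′ ∣) (∣ ν ∣) (∣ μ ∣) w ⟩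
      w * (∣ M₂₁′ ∣ + ∣ ν ∣ + ∣ μ ∣)        ∎)
      where
      open ≤-Reasoning
      t a a′ w w′ : ZX (suc m)
      t  = ι (suc J)
      a  = ∣ e c K ∣
      a′ = ∣ e c (3 ℕ.+ K) ∣
      w  = ∣ W c K ∣
      w′ = ∣ W c (3 ℕ.+ K) ∣
      w-pos : Positive w
      w-pos = ∣x∣-pos (λ W≡𝟘 → Q≢𝟘 (cong proj₁ W≡𝟘))
      γW≡ : γ * W c K ≡ e c (3 ℕ.+ K) + - (μ * e c K)
      γW≡ = trans (LS.solve 2 (λ x y → y LS.:= (x LS.:+ y) LS.:+ LS.:- x) refl (μ * e c K) (γ * W c K))
                  (cong (_+ - (μ * e c K)) (sym (e-period K)))
      a≤w : a ≤ w
      a≤w = <⇒≤ (≤-<-trans (x≤ι-suc*x J (∣x∣-nonNeg _)) ta<w)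
      w′≤ : w′ ≤ ∣ M₂₁′ ∣ * w + ∣ ν ∣ * w
      w′≤ = ≤-trans (subst₂ _≤_ (cong ∣_∣ (sym (W-period K))) (cong₂ _+_ (∣x*y∣≡∣x∣*∣y∣ _ _) (∣x*y∣≡∣x∣*∣y∣ _ _)) (∣∣-triangle _ _))
                    (+-mono-≤ (*-monoˡ-≤ (∣x∣-nonNeg _) a≤w) ≤-refl)

    γ≡𝟘 : γ ≡ 𝟘
    γ≡𝟘 = bounded-multiples⇒≡𝟘 γ _ λ J → γ-bounded′ J (close J)
      where
      γ-bounded′ : ∀ J → ∃[ K ] (∀ k → K ℕ.≤ k → Close c J k) → ι (suc J) * ∣ γ ∣ < ∣ M₂₁′ ∣ + ∣ ν ∣ + ∣ μ ∣
      γ-bounded′ J (K , h) = γ-bounded J K (h K ℕₚ.≤-refl) (proj₂ (h (3 ℕ.+ K) (ℕₚ.m≤n+m K 3)))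

    p q : ZX m
    p = a₂
    q = a₂ B.* a₃ B.+ B.𝟙

    M₁₂≡dq : m12 M ≡ d B.* q
    M₁₂≡dq = trans (B.x-y≡𝟘⇒x≡y (cong proj₁ γ≡𝟘)) (cong (d B.*_) M₂₁≡)

    M₁₁≡p : m11 M ≡ p
    M₁₁≡p = trans (B.x-y≡𝟘⇒x≡y (cong proj₂ γ≡𝟘)) M₂₂≡

    N≡-1 : relNorm m (p , q) ≡ B.- B.𝟙
    N≡-1 = begin
      p B.* p B.- d B.* (q B.* q)              ≡⟨ cong₂ (λ x y → x B.* x B.- d B.* (y B.* y)) (sym M₂₂≡) (sym M₂₁≡) ⟩
      m22 M B.* m22 M B.- d B.* (m21 M B.* m21 M)
        ≡⟨ solve 3 (λ f e d → f :* f :- d :* (e :* e) := f :* f :- (d :* e) :* e) refl (m22 M) (m21 M) d ⟩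
      m22 M B.* m22 M B.- (d B.* m21 M) B.* m21 M
        ≡⟨ cong₂ (λ x y → x B.* m22 M B.- y B.* m21 M) (sym (trans M₁₁≡p (sym M₂₂≡))) (sym (trans M₁₂≡dq (cong (d B.*_) (sym M₂₁≡)))) ⟩
      m11 M B.* m22 M B.- m12 M B.* m21 M      ≡⟨ det≡-1 ⟩
      B.- B.𝟙                                  ∎
      where open ≡-Reasoning

    p*a₁≡dq-𝟙 : p B.* a₁ ≡ d B.* q B.- B.𝟙
    p*a₁≡dq-𝟙 = begin
      a₂ B.* a₁                   ≡⟨ solve 2 (λ a₁ a₂ → a₂ :* a₁ := (a₁ :* a₂ :+ con (+ 1)) :- con (+ 1)) refl a₁ a₂ ⟩
      (a₁ B.* a₂ B.+ B.𝟙) B.- B.𝟙  ≡⟨ cong (B._- B.𝟙) (trans (sym M₁₂≡) M₁₂≡dq) ⟩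
      d B.* q B.- B.𝟙             ∎
      where open ≡-Reasoning

    p*a₃≡q-𝟙 : p B.* a₃ ≡ q B.- B.𝟙
    p*a₃≡q-𝟙 = solve 2 (λ a₂ a₃ → a₂ :* a₃ := (a₂ :* a₃ :+ con (+ 1)) :- con (+ 1)) refl a₂ a₃

    open UnitPeriod c p q (λ k → trans (P-period k) (cong₂ (λ x y → x B.* P k B.+ y B.* Q k) M₁₁≡p M₁₂≡dq))
                          (λ k → trans (Q-period k) (cong₂ (λ x y → x B.* P k B.+ y B.* Q k) M₂₁≡ M₂₂≡)) N≡-1

    -- If pq ≤ 0 then |ε| ≤ 1 ≤ |ε̄|: along k ↦ k + 3 the |e_k| never shrink and the |f_k| never grow,
    -- which is incompatible with (J + 1)|e_k| < |f_k| holding eventually for every J.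
    pq≤𝟘⇒⊥ : B.NonNeg (B.- (p B.* q)) → ⊥
    pq≤𝟘⇒⊥ -pq≥𝟘 = proj₁ (proj₂ (close 0) K₀ ℕₚ.≤-refl) Q≡𝟘
      where
      α≤𝟙≤β : ∣ ε ∣ ≤ 𝟙 × 𝟙 ≤ ∣ ε̄ ∣
      α≤𝟙≤β = α≤β⇒α≤𝟙≤β (squares-≤⇒≤ (∣x∣-nonNeg ε) (∣x∣-nonNeg ε̄) (subst (_≢ negative) (sym sign-β²-α²) -pq≥𝟘))
        where
        sign-β²-α² : sign (suc m) (∣ ε̄ ∣ * ∣ ε̄ ∣ - ∣ ε ∣ * ∣ ε ∣) ≡ sign m (B.- (p B.* q))
        sign-β²-α² = trans (sign-sub-swap _ _) (trans (cong flip sign-∣ε∣²-∣ε̄∣²) (sym (B.sign-neg _)))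
      e-grows : ∀ k → ∣ e c k ∣ ≤ ∣ e c (3 ℕ.+ k) ∣
      e-grows k = subst (∣ e c k ∣ ≤_) (trans (*-comm _ _) (sym (∣e∣-period k))) (x≤x*y (∣x∣-nonNeg _) (proj₂ α≤𝟙≤β))
      f-shrinks : ∀ k → ∣ f c (3 ℕ.+ k) ∣ ≤ ∣ f c k ∣
      f-shrinks k = subst (_≤ ∣ f c k ∣) (trans (*-comm _ _) (sym (∣f∣-period k))) (x*y≤x (∣x∣-nonNeg _) (proj₁ α≤𝟙≤β))
      K₀ : ℕ
      K₀ = proj₁ (close 0)
      bounded : ∀ J → ι (suc J) * ∣ e c K₀ ∣ < ∣ f c K₀ ∣
      bounded J = bounded′ (close J)
        where
        bounded′ : ∃[ K ] (∀ k → K ℕ.≤ k → Close c J k) → ι (suc J) * ∣ e c K₀ ∣ < ∣ f c K₀ ∣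
        bounded′ (K , h) = ≤-<-trans (*-monoˡ-≤ (ι-nonNeg (suc J)) (chain-3 _≤_ ≤-trans ≤-refl _ e-grows K₀ K))
                             (<-≤-trans (close⇒<∣f∣ J _ _ (proj₂ (h (K ℕ.* 3 ℕ.+ K₀) K≤k)))
                                        (chain-3 (λ x y → y ≤ x) (λ h₁ h₂ → ≤-trans h₂ h₁) ≤-refl _ f-shrinks K₀ K))
          where
          K≤k : K ℕ.≤ K ℕ.* 3 ℕ.+ K₀
          K≤k = ℕₚ.≤-trans (ℕₚ.m≤m*n K 3) (ℕₚ.m≤m+n _ K₀)
      Q≡𝟘 : qconv m c K₀ ≡ B.𝟘
      Q≡𝟘 = trans (solve 1 (λ Q → Q := :- (:- Q)) refl _)
                  (trans (cong B.-_ (cong proj₂ (bounded-multiples⇒≡𝟘 (e c K₀) _ bounded)))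
                         (solve 0 (:- con (+ 0) := con (+ 0)) refl))

    pq-pos : Pos m (p B.* q)
    pq-pos = [ id , ⊥-elim ∘ pq≤𝟘⇒⊥ ]′ (B.pos⊎-nonNeg (p B.* q))

theorem3p3 : (m : ℕ) →
    ((a1 a2 a3 : ZX m) →
      HasType (cyc3 a1 a2 a3) 0 3 →
      CFEqualsX m (cyc3 a1 a2 a3) →
      ∃[ ε ] (RE⁻ m ε ×
        mul m (pe m ε) a1 ≡ sub m (mul m (genSq m) (qe m ε)) (1# m) ×
        a2 ≡ pe m ε ×
        mul m (pe m ε) a3 ≡ sub m (qe m ε) (1# m) ×
        Pos m (mul m (pe m ε) (qe m ε))))
    ×
    ((ε : ZX (suc m)) → RE⁻ m ε →
      (b1 b3 : ZX m) →
      mul m (pe m ε) b1 ≡ sub m (mul m (genSq m) (qe m ε)) (1# m) →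
      mul m (pe m ε) b3 ≡ sub m (qe m ε) (1# m) →
      Pos m (mul m (pe m ε) (qe m ε)) →
      CFEqualsX m (cyc3 b1 (pe m ε) b3))
theorem3p3 m =
    (λ a₁ a₂ a₃ _ cf → let open Forward a₁ a₂ a₃ (fromCFEqualsX _ cf)
                       in (p , q) , N≡-1 , p*a₁≡dq-𝟙 , refl , p*a₃≡q-𝟙 , pq-pos)
  , (λ { (p , q) N≡-1 b₁ b₃ h₁ h₃ pq-pos → toCFEqualsX _ (Converse.eventually-close p q b₁ b₃ N≡-1 h₁ h₃ pq-pos) })
  where open ContinuedFraction m
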